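{- Let $S\subset\mathbb{F}_q^k$ be an arc, let $t=q+k-1-|S|$, let $n\ge 0$, and let $G\subset S$ be a subfamily of size $t+k+n$. For each $A\in\binom{G}{k-2}$ fix a basis $B(A)=(b_1,b_2,A)$ of $\mathbb{F}_q^k$ (two vectors $b_1,b_2$ followed by the elements of $A$ in order). Let $P_G^{\uparrow n}$ be the matrix whose rows are indexed by $\binom{G}{k-1}$, whose columns are indexed by ordered pairs $(U,A)$ with $U\in\binom{G}{n}$, $A\in\binom{G\setminus U}{k-2}$, and whose $(C,(U,A))$-entry is \[ f_{A,S}(C\setminus A)\prod_{y\in G\setminus(C\cup U)}\det(C\setminus A,y,A)_{B(A)}^{ -1} \] if $A\subset C\subset G\setminus U$, and $0$ otherwise. Then $\vec{1}P_G^{\uparrow n}=\vec{0}$, where $\vec 1$ is the all-ones row vector.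
   Context: $\mathbb{F}_q$ is a finite field of order $q$. An arc in $\mathbb{F}_q^k$ is an ordered family of at least $k$ vectors in which every subfamily of size $k$ is a basis; subfamilies inherit the order. $\binom{X}{m}$ is the set of $m$-subsets of $X$. Tangent function: for an arc $S$ and $A\in\binom{S}{k-2}$, let $H_A^1,\dots,H_A^m$ be all the $(k-1)$-dimensional subspaces of $\mathbb{F}_q^k$ whose intersection with $S$ is exactly $A$, let $\beta_A^i$ be a linear functional with kernel $H_A^i$, and set $f_{A,S}(x)=\prod_{i=1}^m\beta_A^i(x)$ (defined up to a nonzero scalar; any choice may be used). When $C\setminus A$ is a single vector $c$, $f_{A,S}(C\setminus A)$ means $f_{A,S}(c)$. For vectors $x,y$ and a basis $B$, $\det(x,y,A)_B$ is the determinant of the matrix whose rows are $x$, $y$, and the elements of $A$ in order, all written in coordinates with respect to $B$. -}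

module Defs where

open import Level using (Level; _⊔_) renaming (suc to lsuc)
open import Algebra.Bundles using (CommutativeRing)
open import Data.Nat using (ℕ; zero; suc; _∸_)
open import Data.Bool using (Bool; true; false; if_then_else_; _∧_)
open import Data.Fin using (Fin; zero; suc; punchIn)
open import Data.Fin.Subset using (Subset; _⊆_; _─_; _∪_; ∣_∣)
open import Data.Fin.Subset.Properties using (_⊆?_)
open import Data.List using (List; []; _∷_; map; foldr)
open import Data.List.Relation.Unary.Any using (Any)
open import Data.List.Relation.Unary.AllPairs using (AllPairs)
open import Data.Product using (Σ; ∃; _×_)
open import Relation.Nullary using (¬_; does)
open import Relation.Binary.PropositionalEquality using (_≡_)
open import Function.Definitions using (Injective)
import Data.Nat as ℕ
import Data.Vec as V

-- The inverse is a total operation whose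
-- value at 0 is unconstrained (it is only ever applied to nonzero
-- elements in the statement).

record Field (c ℓ : Level) : Set (lsuc (c ⊔ ℓ)) where
  field
    commutativeRing : CommutativeRing c ℓ
  open CommutativeRing commutativeRing public
  field
    _⁻¹        : Carrier → Carrier
    ⁻¹-inverse : ∀ x → ¬ (x ≈ 0#) → (x * (x ⁻¹)) ≈ 1#
    0≉1        : ¬ (0# ≈ 1#)

elems : ∀ {n} → Subset n → List (Fin n)
elems {zero}  _            = []
elems {suc n} (true  V.∷ p)  = zero ∷ map suc (elems p)
elems {suc n} (false V.∷ p)  = map suc (elems p)

-- A list turned into a Fin m-indexed family (padded with a default;
-- the padding is never used when the list has length m).
listFam : ∀ {a} {V : Set a} {m} → List V → V → Fin m → V
listFam []       d _       = d
listFam (x ∷ xs) d zero    = x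
listFam (x ∷ xs) d (suc i) = listFam xs d i

module FieldDefs {c ℓ : Level} (F : Field c ℓ) where
  open Field F using (Carrier; _≈_; _+_; _*_; -_; 0#; 1#; _⁻¹)

  HasOrder : ℕ → Set (c ⊔ ℓ)
  HasOrder q = Σ (Fin q → Carrier) λ e →
    (∀ i j → e i ≈ e j → i ≡ j) × (∀ x → ∃ λ i → x ≈ e i)

  Vec : ℕ → Set c
  Vec k = Fin k → Carrier

  _≈ᵥ_ : ∀ {k} → Vec k → Vec k → Set ℓ
  u ≈ᵥ v = ∀ i → u i ≈ v i

  0ᵥ : ∀ {k} → Vec k
  0ᵥ _ = 0#

  sumFin : ∀ {m} → (Fin m → Carrier) → Carrier
  sumFin {zero}  f = 0#
  sumFin {suc m} f = f zero + sumFin (λ i → f (suc i))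

  lincomb : ∀ {m k} → (Fin m → Carrier) → (Fin m → Vec k) → Vec k
  lincomb a v j = sumFin (λ i → a i * v i j)

  apply : ∀ {k} → Vec k → Vec k → Carrier
  apply β x = sumFin (λ j → β j * x j)

  LinIndep : ∀ {m k} → (Fin m → Vec k) → Set (c ⊔ ℓ)
  LinIndep v = ∀ a → lincomb a v ≈ᵥ 0ᵥ → ∀ i → a i ≈ 0#

  Spans : ∀ {m k} → (Fin m → Vec k) → Set (c ⊔ ℓ)
  Spans v = ∀ x → ∃ λ a → lincomb a v ≈ᵥ x

  IsBasis : ∀ {m k} → (Fin m → Vec k) → Set (c ⊔ ℓ)
  IsBasis v = LinIndep v × Spans v

  IsArc : ∀ {k N} → (Fin N → Vec k) → Set (c ⊔ ℓ)
  IsArc {k} {N} S =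
    (k ℕ.≤ N) × (∀ (ι : Fin k → Fin N) → Injective _≡_ _≡_ ι → IsBasis (λ i → S (ι i)))

  sgn : ∀ {m} → Fin m → Carrier
  sgn zero    = 1#
  sgn (suc j) = - sgn j

  det : ∀ {m} → (Fin m → Vec m) → Carrier
  det {zero}  M = 1#
  det {suc m} M = sumFin (λ j → sgn j * (M zero j * det (λ r col → M (suc r) (punchIn j col))))

  family : ∀ {N k} → Vec k → Vec k → (Fin N → Vec k) → Subset N → Fin k → Vec k
  family x y S A = listFam (x ∷ y ∷ map S (elems A)) 0ᵥ

  MeetsExactly : ∀ {N k} → (Fin N → Vec k) → Subset N → Vec k → Set ℓ
  MeetsExactly S A β = ∀ i → ((apply β (S i) ≈ 0#) → i Data.Fin.Subset.∈ A)
                            × (i Data.Fin.Subset.∈ A → apply β (S i) ≈ 0#)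

  NonZero : ∀ {k} → Vec k → Set ℓ
  NonZero β = ¬ (β ≈ᵥ 0ᵥ)

  SameKernel : ∀ {k} → Vec k → Vec k → Set (c ⊔ ℓ)
  SameKernel β γ = ∀ x → ((apply β x ≈ 0#) → (apply γ x ≈ 0#)) × ((apply γ x ≈ 0#) → (apply β x ≈ 0#))

  -- βs lists linear functionals whose kernels are exactly (without
  -- repetition) all hyperplanes H with H ∩ S = A.
  TangentFunctionals : ∀ {N k} → (Fin N → Vec k) → Subset N → List (Vec k) → Set (c ⊔ ℓ)
  TangentFunctionals S A βs =
    Data.List.Relation.Unary.All.All (λ β → NonZero β × MeetsExactly S A β) βs
    × AllPairs (λ β γ → ¬ SameKernel β γ) βs
    × (∀ γ → NonZero γ → MeetsExactly S A γ → Any (SameKernel γ) βs)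
    where import Data.List.Relation.Unary.All

  tangent : ∀ {k} → List (Vec k) → Vec k → Carrier
  tangent βs x = foldr (λ β r → apply β x * r) 1# βs

  sumOver : ∀ {N} → Subset N → (Fin N → Carrier) → Carrier
  sumOver p g = foldr (λ i r → g i + r) 0# (elems p)

  prodOver : ∀ {N} → Subset N → (Fin N → Carrier) → Carrier
  prodOver p g = foldr (λ i r → g i * r) 1# (elems p)

  sumSubsets : ∀ {N} → (Subset N → Carrier) → Carrier
  sumSubsets {zero}  f = f Data.Vec.[]
    where import Data.Vec
  sumSubsets {suc N} f = sumSubsets (λ p → f (false Data.Vec.∷ p)) + sumSubsets (λ p → f (true Data.Vec.∷ p))
    where import Data.Vec

  -- Here
  --   S   : the arc, G : the subfamily (as a set of indices),
  --   βs  : the chosen tangent functionals for each A (f_{A,S} = tangent (βs A)),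
  --   crd : coordinates with respect to B(A)  (crd A x = coordinates of x).
  -- When A ⊆ C and |C| = |A| + 1, C ─ A is a singleton {c}, so the sum over
  -- c ∈ C ─ A is just the single term for that c.
  Pentry : ∀ {N k} → (Fin N → Vec k) → Subset N →
           (Subset N → List (Vec k)) → (Subset N → Vec k → Vec k) →
           Subset N → Subset N → Subset N → Carrier
  Pentry S G βs crd C U A =
    if does (A ⊆? C) ∧ does (C ⊆? (G ─ U))
    then sumOver (C ─ A) (λ c →
           tangent (βs A) (S c) *
           prodOver (G ─ (C ∪ U)) (λ y →
             (det (family (crd A (S c)) (crd A (S y)) (λ i → crd A (S i)) A)) ⁻¹))
    else 0#

  onesTimesP : ∀ {N k} → (Fin N → Vec k) → Subset N →
               (Subset N → List (Vec k)) → (Subset N → Vec k → Vec k) →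
               Subset N → Subset N → Carrier
  onesTimesP {k = k} S G βs crd U A =
    sumSubsets (λ C → if does (C ⊆? G) ∧ does (∣ C ∣ ℕ.≟ (k ∸ 1))
                      then Pentry S G βs crd C U A else 0#)

module Submission where

-- Fix the column (U , A) and put D = (G ∖ U) ∖ A.  Only the rows C = A ∪ {c},
-- c ∈ D, contribute, so the column sum is
--   Σ_{c ∈ D} f_{A,S}(c) · Π_{y ∈ D ∖ c} det(c , y , A)⁻¹ .
-- In coordinates with respect to B(A) = (b₁ , b₂ , A) only the first two
-- coordinates π(x) ∈ F² of a vector matter: det(x , y , A) is the 2 × 2
-- determinant det₂(π x , π y), and every tangent functional β (it vanishes on A)
-- satisfies β(x) = det₂(π x , w β) for a fixed w β ∈ F².  The column sum thus
-- becomes the interpolation sum  Σ_{c ∈ D} Π_w det₂(π c , w) Π_{y ≠ c} det₂(π c , π y)⁻¹,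
-- which vanishes when the points π(c) are pairwise independent and
-- |D| = (number of tangents) + 2.  Independence is the arc property; the size
-- condition is a count: the q + 1 points of the projective line over F_q are
-- exactly the directions π(S i), i ∉ A, and w β, each hit once.

open import Defs
open import Level using (Level)
open import Algebra.Bundles using (RawRing; CommutativeRing; CommutativeMonoid)
open import Data.Bool using (Bool; true; false; if_then_else_; _∧_)
open import Data.Empty using (⊥; ⊥-elim)
open import Data.Fin using (Fin; zero; suc; punchIn; fromℕ<)
open import Data.Fin.Subset using (Subset; _⊆_; _─_; ∣_∣; _∈_; _∉_; ⁅_⁆; _∪_; ∁)
open import Data.List using (List; []; _∷_)
open import Data.List.Membership.Propositional using (find) renaming (_∈_ to _∈ₗ_)
open import Data.List.Relation.Unary.All using (All; []; _∷_)
open import Data.List.Relation.Unary.AllPairs using (AllPairs; []; _∷_)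
import Data.List.Relation.Unary.AllPairs as AllPairs
open import Data.List.Relation.Unary.Any as Any using (here; there)
open import Data.Maybe using (Maybe; nothing; just)
open import Data.Nat using (ℕ; zero; suc; z≤n; s≤s)
open import Data.Product using (_×_; _,_; proj₁; proj₂; Σ; ∃)
open import Data.Sum using (_⊎_; inj₁; inj₂; [_,_])
open import Function.Definitions using (Injective)
open import Relation.Nullary using (yes; no; Dec; ¬_; does)
open import Relation.Nullary.Decidable using (¬?; _×-dec_)
import Data.Fin.Properties as FinP
import Data.Fin.Subset as Sub
import Data.Fin.Subset.Properties as SubP
import Data.List as L
import Data.List.Membership.Propositional.Properties as ∈ₗP
import Data.List.Properties as LP
import Data.List.Relation.Unary.All as All
import Data.List.Relation.Unary.All.Properties as AllP
import Data.List.Relation.Unary.AllPairs.Properties as AllPairsP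
import Data.List.Relation.Unary.Any.Properties as AnyP
import Data.Nat as ℕ
import Data.Nat.Properties as ℕP
import Data.Vec.Base as V
import Relation.Binary.PropositionalEquality as P

Distinct : ∀ {a} {X : Set a} → List X → Set a
Distinct = AllPairs (λ x y → x P.≢ y)

-- A ring solver with integer coefficients for an arbitrary commutative
-- ring: integers are pairs (a , b) of naturals standing for a − b, kept in
-- the normal form where one component is 0, and interpreted in the ring
-- through n ↦ 1 + ⋯ + 1.  (The library's solvers need ℕ coefficients or a
-- decidable equality on the carrier, neither of which fits a ring with negation.)

module IntegerSolver {c ℓ : Level} (CR : CommutativeRing c ℓ) where
  open CommutativeRing CR hiding (zero)
  open import Relation.Binary.Reasoning.Setoid setoid
  open import Algebra.Properties.Ring ring using (-‿distribˡ-*; -‿distribʳ-*; -‿involutive; -‿+-comm; -0#≈0#)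

  ℤ² : Set
  ℤ² = ℕ × ℕ

  canonical : ℕ → ℕ → ℤ²
  canonical (suc a) (suc b) = canonical a b
  canonical a b = (a , b)

  _⊕_ _⊗_ : ℤ² → ℤ² → ℤ²
  (a , b) ⊕ (c , d) = canonical (a ℕ.+ c) (b ℕ.+ d)
  (a , b) ⊗ (c , d) = canonical (a ℕ.* c ℕ.+ b ℕ.* d) (a ℕ.* d ℕ.+ b ℕ.* c)

  ⊖ : ℤ² → ℤ²
  ⊖ (a , b) = (b , a)

  ℤ²-rawRing : RawRing _ _
  ℤ²-rawRing = record { Carrier = ℤ² ; _≈_ = P._≡_ ; _+_ = _⊕_ ; _*_ = _⊗_ ; -_ = ⊖ ; 0# = (0 , 0) ; 1# = (1 , 0) }

  ofℕ : ℕ → Carrier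
  ofℕ zero    = 0#
  ofℕ (suc n) = 1# + ofℕ n

  ofℕ-+ : ∀ m n → ofℕ (m ℕ.+ n) ≈ ofℕ m + ofℕ n
  ofℕ-+ zero    n = sym (+-identityˡ _)
  ofℕ-+ (suc m) n = trans (+-congˡ (ofℕ-+ m n)) (sym (+-assoc _ _ _))

  ofℕ-* : ∀ m n → ofℕ (m ℕ.* n) ≈ ofℕ m * ofℕ n
  ofℕ-* zero    n = sym (zeroˡ _)
  ofℕ-* (suc m) n = begin
    ofℕ (n ℕ.+ m ℕ.* n)         ≈⟨ ofℕ-+ n (m ℕ.* n) ⟩
    ofℕ n + ofℕ (m ℕ.* n)       ≈⟨ +-cong (sym (*-identityˡ _)) (ofℕ-* m n) ⟩
    1# * ofℕ n + ofℕ m * ofℕ n  ≈⟨ sym (distribʳ _ _ _) ⟩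
    (1# + ofℕ m) * ofℕ n        ∎

  -- The interpretation of (a , b) as a − b; the two special cases make the
  -- constants 0 and 1 evaluate to 0# and 1# on the nose.
  ⟦_⟧ᶻ : ℤ² → Carrier
  ⟦ zero , zero ⟧ᶻ     = 0#
  ⟦ suc zero , zero ⟧ᶻ = 1#
  ⟦ a , b ⟧ᶻ           = ofℕ a - ofℕ b

  ⟦⟧ᶻ-sub : ∀ p → ⟦ p ⟧ᶻ ≈ ofℕ (proj₁ p) - ofℕ (proj₂ p)
  ⟦⟧ᶻ-sub (zero , zero)          = sym (trans (+-congˡ -0#≈0#) (+-identityʳ _))
  ⟦⟧ᶻ-sub (suc zero , zero)      = sym (trans (+-congˡ -0#≈0#) (trans (+-identityʳ _) (+-identityʳ _)))
  ⟦⟧ᶻ-sub (zero , suc b)         = refl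
  ⟦⟧ᶻ-sub (suc zero , suc b)     = refl
  ⟦⟧ᶻ-sub (suc (suc a) , b)      = refl

  +-sub-interchange : ∀ x y z w → (x + y) - (z + w) ≈ (x - z) + (y - w)
  +-sub-interchange x y z w = begin
    (x + y) + - (z + w)    ≈⟨ +-congˡ (sym (-‿+-comm z w)) ⟩
    (x + y) + (- z + - w)  ≈⟨ interchange x y (- z) (- w) ⟩
    (x + - z) + (y + - w)  ∎
    where open import Algebra.Properties.CommutativeSemigroup +-commutativeSemigroup using (interchange)

  canonical-sound : ∀ a b → ⟦ canonical a b ⟧ᶻ ≈ ofℕ a - ofℕ b
  canonical-sound zero    b       = ⟦⟧ᶻ-sub (zero , b)
  canonical-sound (suc a) zero    = ⟦⟧ᶻ-sub (suc a , zero)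
  canonical-sound (suc a) (suc b) = begin
    ⟦ canonical a b ⟧ᶻ               ≈⟨ canonical-sound a b ⟩
    ofℕ a - ofℕ b                    ≈⟨ sym (+-identityˡ _) ⟩
    0# + (ofℕ a - ofℕ b)             ≈⟨ +-congʳ (sym (-‿inverseʳ 1#)) ⟩
    (1# - 1#) + (ofℕ a - ofℕ b)      ≈⟨ sym (+-sub-interchange 1# (ofℕ a) 1# (ofℕ b)) ⟩
    (1# + ofℕ a) - (1# + ofℕ b)      ∎

  ⊕-homo : ∀ p q → ⟦ p ⊕ q ⟧ᶻ ≈ ⟦ p ⟧ᶻ + ⟦ q ⟧ᶻ
  ⊕-homo (a , b) (c , d) = begin
    ⟦ canonical (a ℕ.+ c) (b ℕ.+ d) ⟧ᶻ     ≈⟨ canonical-sound (a ℕ.+ c) (b ℕ.+ d) ⟩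
    ofℕ (a ℕ.+ c) - ofℕ (b ℕ.+ d)          ≈⟨ +-cong (ofℕ-+ a c) (-‿cong (ofℕ-+ b d)) ⟩
    (ofℕ a + ofℕ c) - (ofℕ b + ofℕ d)      ≈⟨ +-sub-interchange _ _ _ _ ⟩
    (ofℕ a - ofℕ b) + (ofℕ c - ofℕ d)      ≈⟨ sym (+-cong (⟦⟧ᶻ-sub (a , b)) (⟦⟧ᶻ-sub (c , d))) ⟩
    ⟦ a , b ⟧ᶻ + ⟦ c , d ⟧ᶻ                ∎

  sub-*-sub : ∀ x y z w → (x - y) * (z - w) ≈ (x * z + y * w) - (x * w + y * z)
  sub-*-sub x y z w = begin
    (x + - y) * (z + - w)                           ≈⟨ distribʳ _ _ _ ⟩
    x * (z + - w) + - y * (z + - w)                 ≈⟨ +-cong (distribˡ _ _ _) (distribˡ _ _ _) ⟩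
    (x * z + x * - w) + (- y * z + - y * - w)       ≈⟨ +-cong (+-congˡ (sym (-‿distribʳ-* x w))) (+-cong (sym (-‿distribˡ-* y z)) neg-neg) ⟩
    (x * z + - (x * w)) + (- (y * z) + y * w)       ≈⟨ +-congˡ (+-comm _ _) ⟩
    (x * z + - (x * w)) + (y * w + - (y * z))       ≈⟨ sym (+-sub-interchange _ _ _ _) ⟩
    (x * z + y * w) - (x * w + y * z)               ∎
    where
    neg-neg : - y * - w ≈ y * w
    neg-neg = trans (sym (-‿distribˡ-* y (- w))) (trans (-‿cong (sym (-‿distribʳ-* y w))) (-‿involutive _))

  ⊗-homo : ∀ p q → ⟦ p ⊗ q ⟧ᶻ ≈ ⟦ p ⟧ᶻ * ⟦ q ⟧ᶻ
  ⊗-homo (a , b) (c , d) = begin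
    ⟦ canonical (ac ℕ.+ bd) (ad ℕ.+ bc) ⟧ᶻ                          ≈⟨ canonical-sound (ac ℕ.+ bd) (ad ℕ.+ bc) ⟩
    ofℕ (ac ℕ.+ bd) - ofℕ (ad ℕ.+ bc)                               ≈⟨ +-cong (ofℕ-bilinear a c b d) (-‿cong (ofℕ-bilinear a d b c)) ⟩
    (ofℕ a * ofℕ c + ofℕ b * ofℕ d) - (ofℕ a * ofℕ d + ofℕ b * ofℕ c) ≈⟨ sym (sub-*-sub _ _ _ _) ⟩
    (ofℕ a - ofℕ b) * (ofℕ c - ofℕ d)                               ≈⟨ sym (*-cong (⟦⟧ᶻ-sub (a , b)) (⟦⟧ᶻ-sub (c , d))) ⟩
    ⟦ a , b ⟧ᶻ * ⟦ c , d ⟧ᶻ                                         ∎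
    where
    ac = a ℕ.* c ; bd = b ℕ.* d ; ad = a ℕ.* d ; bc = b ℕ.* c
    ofℕ-bilinear : ∀ x y z w → ofℕ (x ℕ.* y ℕ.+ z ℕ.* w) ≈ ofℕ x * ofℕ y + ofℕ z * ofℕ w
    ofℕ-bilinear x y z w = trans (ofℕ-+ (x ℕ.* y) (z ℕ.* w)) (+-cong (ofℕ-* x y) (ofℕ-* z w))

  ⊖-homo : ∀ p → ⟦ ⊖ p ⟧ᶻ ≈ - ⟦ p ⟧ᶻ
  ⊖-homo (a , b) = begin
    ⟦ b , a ⟧ᶻ                 ≈⟨ ⟦⟧ᶻ-sub (b , a) ⟩
    ofℕ b + - ofℕ a            ≈⟨ +-comm _ _ ⟩
    - ofℕ a + ofℕ b            ≈⟨ +-congˡ (sym (-‿involutive _)) ⟩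
    - ofℕ a + - - ofℕ b        ≈⟨ -‿+-comm _ _ ⟩
    - (ofℕ a + - ofℕ b)        ≈⟨ -‿cong (sym (⟦⟧ᶻ-sub (a , b))) ⟩
    - ⟦ a , b ⟧ᶻ               ∎

  open import Algebra.Solver.Ring.AlmostCommutativeRing
    using (fromCommutativeRing; _-Raw-AlmostCommutative⟶_)

  ℤ²-morphism : ℤ²-rawRing -Raw-AlmostCommutative⟶ fromCommutativeRing CR
  ℤ²-morphism = record
    { ⟦_⟧ = ⟦_⟧ᶻ ; +-homo = ⊕-homo ; *-homo = ⊗-homo ; -‿homo = ⊖-homo
    ; 0-homo = refl ; 1-homo = refl }

  ℤ²-equal? : ∀ p q → Maybe (⟦ p ⟧ᶻ ≈ ⟦ q ⟧ᶻ)
  ℤ²-equal? (a , b) (c , d) with a ℕ.≟ c | b ℕ.≟ d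
  ... | yes P.refl | yes P.refl = just refl
  ... | _          | _          = nothing

  open import Algebra.Solver.Ring ℤ²-rawRing (fromCommutativeRing CR) ℤ²-morphism ℤ²-equal?
    public using (solve; _:=_; _:+_; _:*_; _:-_; :-_; con; Polynomial)

  :1 :0 : ∀ {n} → Polynomial n
  :1 = con (1 , 0)
  :0 = con (0 , 0)

module SubsetFold {a b : Level} (M : CommutativeMonoid a b) where
  open CommutativeMonoid M
  open import Relation.Binary.Reasoning.Setoid setoid
  open import Algebra.Properties.CommutativeSemigroup commutativeSemigroup using (interchange; x∙yz≈y∙xz)

  fold : ∀ {N} → Subset N → (Fin N → Carrier) → Carrier
  fold p g = L.foldr (λ i r → g i ∙ r) ε (elems p)

  private
    fold-map-suc : ∀ {N} (l : List (Fin N)) (g : Fin (suc N) → Carrier) →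
      L.foldr (λ i r → g i ∙ r) ε (L.map suc l) P.≡ L.foldr (λ i r → g (suc i) ∙ r) ε l
    fold-map-suc []      g = P.refl
    fold-map-suc (x ∷ l) g = P.cong (g (suc x) ∙_) (fold-map-suc l g)

  fold-inside : ∀ {N} (p : Subset N) g → fold (true V.∷ p) g P.≡ g zero ∙ fold p (λ i → g (suc i))
  fold-inside p g = P.cong (g zero ∙_) (fold-map-suc (elems p) g)

  fold-outside : ∀ {N} (p : Subset N) g → fold (false V.∷ p) g P.≡ fold p (λ i → g (suc i))
  fold-outside p g = fold-map-suc (elems p) g

  fold-cong : ∀ {N} (p : Subset N) {g h : Fin N → Carrier} → (∀ i → i ∈ p → g i ≈ h i) → fold p g ≈ fold p h
  fold-cong {zero}  V.[]           e = refl
  fold-cong {suc N} (true V.∷ p) {g} {h} e = begin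
    fold (true V.∷ p) g                   ≡⟨ fold-inside p g ⟩
    g zero ∙ fold p (λ i → g (suc i))     ≈⟨ ∙-cong (e zero V.here) (fold-cong p (λ i m → e (suc i) (V.there m))) ⟩
    h zero ∙ fold p (λ i → h (suc i))     ≡⟨ fold-inside p h ⟨
    fold (true V.∷ p) h                   ∎
  fold-cong {suc N} (false V.∷ p) {g} {h} e = begin
    fold (false V.∷ p) g                  ≡⟨ fold-outside p g ⟩
    fold p (λ i → g (suc i))              ≈⟨ fold-cong p (λ i m → e (suc i) (V.there m)) ⟩
    fold p (λ i → h (suc i))              ≡⟨ fold-outside p h ⟨
    fold (false V.∷ p) h                  ∎

  fold-empty : ∀ {N} (p : Subset N) (g : Fin N → Carrier) → ∣ p ∣ P.≡ 0 → fold p g ≈ ε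
  fold-empty {zero}  V.[]            g e = refl
  fold-empty {suc N} (false V.∷ p)   g e = trans (reflexive (fold-outside p g)) (fold-empty p (λ i → g (suc i)) e)

  fold-∙ : ∀ {N} (p : Subset N) (g h : Fin N → Carrier) → fold p (λ i → g i ∙ h i) ≈ fold p g ∙ fold p h
  fold-∙ {zero}  V.[]           g h = sym (identityˡ ε)
  fold-∙ {suc N} (true V.∷ p)   g h = begin
    fold (true V.∷ p) (λ i → g i ∙ h i)                               ≡⟨ fold-inside p (λ i → g i ∙ h i) ⟩
    (g zero ∙ h zero) ∙ fold p (λ i → g (suc i) ∙ h (suc i))          ≈⟨ ∙-congˡ (fold-∙ p (λ i → g (suc i)) (λ i → h (suc i))) ⟩
    (g zero ∙ h zero) ∙ (fold p (λ i → g (suc i)) ∙ fold p (λ i → h (suc i))) ≈⟨ interchange _ _ _ _ ⟩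
    (g zero ∙ fold p (λ i → g (suc i))) ∙ (h zero ∙ fold p (λ i → h (suc i))) ≡⟨ P.cong₂ _∙_ (fold-inside p g) (fold-inside p h) ⟨
    fold (true V.∷ p) g ∙ fold (true V.∷ p) h                          ∎
  fold-∙ {suc N} (false V.∷ p)  g h = begin
    fold (false V.∷ p) (λ i → g i ∙ h i)                               ≡⟨ fold-outside p (λ i → g i ∙ h i) ⟩
    fold p (λ i → g (suc i) ∙ h (suc i))                               ≈⟨ fold-∙ p (λ i → g (suc i)) (λ i → h (suc i)) ⟩
    fold p (λ i → g (suc i)) ∙ fold p (λ i → h (suc i))                ≡⟨ P.cong₂ _∙_ (fold-outside p g) (fold-outside p h) ⟨
    fold (false V.∷ p) g ∙ fold (false V.∷ p) h                        ∎

  fold-split : ∀ {N} (p : Subset N) (g : Fin N → Carrier) {x} → x ∈ p → fold p g ≈ g x ∙ fold (p ─ ⁅ x ⁆) g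
  fold-split (true V.∷ p)  g {zero}  V.here = begin
    fold (true V.∷ p) g                       ≡⟨ fold-inside p g ⟩
    g zero ∙ fold p (λ i → g (suc i))         ≡⟨ P.cong (λ z → g zero ∙ fold z (λ i → g (suc i))) (SubP.p─⊥≡p p) ⟨
    g zero ∙ fold (p ─ Sub.⊥) (λ i → g (suc i)) ≡⟨ P.cong (g zero ∙_) (fold-outside (p ─ Sub.⊥) g) ⟨
    g zero ∙ fold (false V.∷ (p ─ Sub.⊥)) g   ∎
  fold-split (true V.∷ p)  g {suc x} (V.there m) = begin
    fold (true V.∷ p) g                                               ≡⟨ fold-inside p g ⟩
    g zero ∙ fold p (λ i → g (suc i))                                 ≈⟨ ∙-congˡ (fold-split p (λ i → g (suc i)) m) ⟩
    g zero ∙ (g (suc x) ∙ fold (p ─ ⁅ x ⁆) (λ i → g (suc i)))         ≈⟨ x∙yz≈y∙xz _ _ _ ⟩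
    g (suc x) ∙ (g zero ∙ fold (p ─ ⁅ x ⁆) (λ i → g (suc i)))         ≡⟨ P.cong (g (suc x) ∙_) (fold-inside (p ─ ⁅ x ⁆) g) ⟨
    g (suc x) ∙ fold (true V.∷ (p ─ ⁅ x ⁆)) g                         ∎
  fold-split (false V.∷ p) g {suc x} (V.there m) = begin
    fold (false V.∷ p) g                                              ≡⟨ fold-outside p g ⟩
    fold p (λ i → g (suc i))                                          ≈⟨ fold-split p (λ i → g (suc i)) m ⟩
    g (suc x) ∙ fold (p ─ ⁅ x ⁆) (λ i → g (suc i))                    ≡⟨ P.cong (g (suc x) ∙_) (fold-outside (p ─ ⁅ x ⁆) g) ⟨
    g (suc x) ∙ fold (false V.∷ (p ─ ⁅ x ⁆)) g                        ∎

size-remove : ∀ {N} (p : Subset N) {x} → x ∈ p → ∣ p ∣ P.≡ suc ∣ p ─ ⁅ x ⁆ ∣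
size-remove (true V.∷ p)  {zero}  V.here      = P.cong suc (P.cong ∣_∣ (P.sym (SubP.p─⊥≡p p)))
size-remove (true V.∷ p)  {suc x} (V.there m) = P.cong suc (size-remove p m)
size-remove (false V.∷ p) {suc x} (V.there m) = size-remove p m

member : ∀ {N n} (p : Subset N) → ∣ p ∣ P.≡ suc n → ∃ λ x → x ∈ p
member (true V.∷ p)  e = zero , V.here
member (false V.∷ p) e with member p e
... | x , m = suc x , V.there m

size-difference : ∀ {N} (X B : Subset N) → B ⊆ X → ∣ X ─ B ∣ ℕ.+ ∣ B ∣ P.≡ ∣ X ∣
size-difference V.[]          V.[]          s = P.refl
size-difference (true V.∷ X)  (true V.∷ B)  s = P.trans (ℕP.+-suc ∣ X ─ B ∣ ∣ B ∣) (P.cong suc (size-difference X B (SubP.drop-∷-⊆ s)))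
size-difference (false V.∷ X) (true V.∷ B)  s with s V.here
... | ()
size-difference (true V.∷ X)  (false V.∷ B) s = P.cong suc (size-difference X B (SubP.drop-∷-⊆ s))
size-difference (false V.∷ X) (false V.∷ B) s = size-difference X B (SubP.drop-∷-⊆ s)

extension-difference : ∀ {N} (A : Subset N) c → c ∉ A → (A ∪ ⁅ c ⁆) ─ A P.≡ ⁅ c ⁆
extension-difference (true V.∷ A)  zero    c∉A = ⊥-elim (c∉A V.here)
extension-difference (false V.∷ A) zero    c∉A = P.cong (true V.∷_) (∪⊥─self A)
  where
  ∪⊥─self : ∀ {N} (A : Subset N) → (A ∪ Sub.⊥) ─ A P.≡ Sub.⊥
  ∪⊥─self V.[]          = P.refl
  ∪⊥─self (true V.∷ A)  = P.cong (false V.∷_) (∪⊥─self A)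
  ∪⊥─self (false V.∷ A) = P.cong (false V.∷_) (∪⊥─self A)
extension-difference (true V.∷ A)  (suc c) c∉A = P.cong (false V.∷_) (extension-difference A c (λ m → c∉A (V.there m)))
extension-difference (false V.∷ A) (suc c) c∉A = P.cong (false V.∷_) (extension-difference A c (λ m → c∉A (V.there m)))

∈-─⁻ : ∀ {N} {p q : Subset N} {x} → x ∈ p ─ q → x ∈ p × x ∉ q
∈-─⁻ {p = p} {q} m = SubP.p─q⊆p p q m , ∉q q m
  where
  ∉q : ∀ {N} {p : Subset N} (q : Subset N) {x} → x ∈ p ─ q → x ∉ q
  ∉q {p = _ V.∷ p} (false V.∷ q) {zero}  V.here      ()
  ∉q {p = _ V.∷ p} (_ V.∷ q)     {suc x} (V.there m) (V.there x∈q) = ∉q q m x∈q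

∈-remove⁻ : ∀ {N} {p : Subset N} {x y} → x ∈ p ─ ⁅ y ⁆ → x ∈ p × x P.≢ y
∈-remove⁻ m = proj₁ (∈-─⁻ m) , λ { P.refl → proj₂ (∈-─⁻ m) (SubP.x∈⁅x⁆ _) }

does-cong : ∀ {a b} {X : Set a} {Y : Set b} (x? : Dec X) (y? : Dec Y) → (X → Y) → (Y → X) → does x? P.≡ does y?
does-cong (yes x) (yes y) f g = P.refl
does-cong (yes x) (no ¬y) f g = ⊥-elim (¬y (f x))
does-cong (no ¬x) (yes y) f g = ⊥-elim (¬x (g y))
does-cong (no ¬x) (no ¬y) f g = P.refl

-- The size bookkeeping of the theorem: with |D| + (k−2) = |G ∖ U|,
-- |G ∖ U| + n = |G|, (N − (k−2)) + (k−2) = N, m + (N − (k−2)) = q + 1 and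
-- |G| + N = q + 2k − 1 + n, the set D has m + 2 elements.
size-arithmetic : ∀ {X m r q k' n GU G N} → X ℕ.+ k' P.≡ GU → GU ℕ.+ n P.≡ G → r ℕ.+ k' P.≡ N →
  m ℕ.+ r P.≡ suc q → G ℕ.+ N P.≡ (q ℕ.+ suc k') ℕ.+ suc (suc k') ℕ.+ n → X P.≡ suc (suc m)
size-arithmetic {X} {m} {r} {q} {k'} {n} P.refl P.refl P.refl count total =
  ℕP.+-cancelʳ-≡ (k' ℕ.+ n ℕ.+ r ℕ.+ k') X (suc (suc m)) (begin
    X ℕ.+ (k' ℕ.+ n ℕ.+ r ℕ.+ k')                 ≡⟨ regroupˡ X k' n r ⟩
    (X ℕ.+ k' ℕ.+ n) ℕ.+ (r ℕ.+ k')               ≡⟨ total ⟩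
    (q ℕ.+ suc k') ℕ.+ suc (suc k') ℕ.+ n         ≡⟨ regroupʳ q k' n ⟩
    suc (suc (suc q)) ℕ.+ (k' ℕ.+ n ℕ.+ k')       ≡⟨ P.cong (λ z → suc (suc z) ℕ.+ (k' ℕ.+ n ℕ.+ k')) count ⟨
    suc (suc (m ℕ.+ r)) ℕ.+ (k' ℕ.+ n ℕ.+ k')     ≡⟨ regroupᵐ m r k' n ⟩
    suc (suc m) ℕ.+ (k' ℕ.+ n ℕ.+ r ℕ.+ k')       ∎)
  where
  open P.≡-Reasoning
  open import Data.Nat.Tactic.RingSolver using (solve-∀)
  regroupˡ : ∀ X k' n r → X ℕ.+ (k' ℕ.+ n ℕ.+ r ℕ.+ k') P.≡ (X ℕ.+ k' ℕ.+ n) ℕ.+ (r ℕ.+ k')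
  regroupˡ = solve-∀
  regroupʳ : ∀ q k' n → (q ℕ.+ suc k') ℕ.+ suc (suc k') ℕ.+ n P.≡ suc (suc (suc q)) ℕ.+ (k' ℕ.+ n ℕ.+ k')
  regroupʳ = solve-∀
  regroupᵐ : ∀ m r k' n → suc (suc (m ℕ.+ r)) ℕ.+ (k' ℕ.+ n ℕ.+ k') P.≡ suc (suc m) ℕ.+ (k' ℕ.+ n ℕ.+ r ℕ.+ k')
  regroupᵐ = solve-∀

elems-sound : ∀ {N} (p : Subset N) {x} → x ∈ₗ elems p → x ∈ p
elems-sound (true V.∷ p)  (here P.refl) = V.here
elems-sound (true V.∷ p)  (there m) with ∈ₗP.∈-map⁻ suc m
... | y , my , P.refl = V.there (elems-sound p my)
elems-sound (false V.∷ p) m with ∈ₗP.∈-map⁻ suc m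
... | y , my , P.refl = V.there (elems-sound p my)

elems-complete : ∀ {N} (p : Subset N) {x} → x ∈ p → x ∈ₗ elems p
elems-complete (true V.∷ p)  V.here      = here P.refl
elems-complete (true V.∷ p)  (V.there m) = there (∈ₗP.∈-map⁺ suc (elems-complete p m))
elems-complete (false V.∷ p) (V.there m) = ∈ₗP.∈-map⁺ suc (elems-complete p m)

elems-length : ∀ {N} (p : Subset N) → L.length (elems p) P.≡ ∣ p ∣
elems-length V.[]          = P.refl
elems-length (true V.∷ p)  = P.cong suc (P.trans (LP.length-map suc (elems p)) (elems-length p))
elems-length (false V.∷ p) = P.trans (LP.length-map suc (elems p)) (elems-length p)

elems-distinct : ∀ {N} (p : Subset N) → Distinct (elems p)
elems-distinct V.[]          = []
elems-distinct (true V.∷ p)  = AllP.map⁺ (All.tabulate (λ _ ())) ∷ distinct-map-suc (elems-distinct p)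
  where
  distinct-map-suc : ∀ {N} {l : List (Fin N)} → Distinct l → Distinct (L.map suc l)
  distinct-map-suc u = AllPairsP.map⁺ (AllPairs.map (λ x≢y e → x≢y (FinP.suc-injective e)) u)
elems-distinct (false V.∷ p) = AllPairsP.map⁺ (AllPairs.map (λ x≢y e → x≢y (FinP.suc-injective e)) (elems-distinct p))

module _ {X : Set} where
  listFam-map : ∀ {b} {Y : Set b} {m} (l : List X) → L.length l P.≡ m → (g : X → Y) (d : Y) (x₀ : X) (i : Fin m) →
    listFam (L.map g l) d i P.≡ g (listFam l x₀ i)
  listFam-map (x ∷ l) P.refl g d x₀ zero    = P.refl
  listFam-map (x ∷ l) P.refl g d x₀ (suc i) = listFam-map l P.refl g d x₀ i

  listFam-∈ : ∀ {m} (l : List X) → L.length l P.≡ m → (x₀ : X) (i : Fin m) → listFam l x₀ i ∈ₗ l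
  listFam-∈ (x ∷ l) P.refl x₀ zero    = here P.refl
  listFam-∈ (x ∷ l) P.refl x₀ (suc i) = there (listFam-∈ l P.refl x₀ i)

  listFam-onto : ∀ {m} (l : List X) → L.length l P.≡ m → (x₀ : X) → ∀ {x} → x ∈ₗ l → Σ (Fin m) λ i → listFam l x₀ i P.≡ x
  listFam-onto (x ∷ l) P.refl x₀ (here P.refl) = zero , P.refl
  listFam-onto (x ∷ l) P.refl x₀ (there m) with listFam-onto l P.refl x₀ m
  ... | i , e = suc i , e

  listFam-injective : ∀ {m} (l : List X) → L.length l P.≡ m → (d : X) → Distinct l → ∀ (i j : Fin m) →
    listFam l d i P.≡ listFam l d j → i P.≡ j
  listFam-injective (x ∷ l) P.refl d (x∉l ∷ u) zero    zero    e = P.refl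
  listFam-injective (x ∷ l) P.refl d (x∉l ∷ u) zero    (suc j) e = ⊥-elim (All.lookup x∉l (listFam-∈ l P.refl d j) e)
  listFam-injective (x ∷ l) P.refl d (x∉l ∷ u) (suc i) zero    e = ⊥-elim (All.lookup x∉l (listFam-∈ l P.refl d i) (P.sym e))
  listFam-injective (x ∷ l) P.refl d (x∉l ∷ u) (suc i) (suc j) e = P.cong suc (listFam-injective l P.refl d u i j e)

-- Pigeonhole in both directions: a list of elements of Fin Q without
-- repetitions that contains every element has length exactly Q.
length-of-enumeration : ∀ {Q} (l : List (Fin Q)) → Distinct l → (∀ y → y ∈ₗ l) → L.length l P.≡ Q
length-of-enumeration {Q} l u c = ℕP.≤-antisym
  (FinP.injective⇒≤ {f = L.lookup l} (λ {i} {j} → lookup-injective l u i j))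
  (FinP.injective⇒≤ {f = λ y → Any.index (c y)}
     (λ {y} {y'} e → P.trans (AnyP.lookup-index (c y)) (P.trans (P.cong (L.lookup l) e) (P.sym (AnyP.lookup-index (c y'))))))
  where
  lookup-injective : ∀ {X : Set} (l : List X) → Distinct l → ∀ (i j : Fin (L.length l)) → L.lookup l i P.≡ L.lookup l j → i P.≡ j
  lookup-injective (x ∷ l) (x∉l ∷ u) zero    zero    e = P.refl
  lookup-injective (x ∷ l) (x∉l ∷ u) zero    (suc j) e = ⊥-elim (All.lookup x∉l (∈ₗP.∈-lookup {xs = l} j) e)
  lookup-injective (x ∷ l) (x∉l ∷ u) (suc i) zero    e = ⊥-elim (All.lookup x∉l (∈ₗP.∈-lookup {xs = l} i) (P.sym e))
  lookup-injective (x ∷ l) (x∉l ∷ u) (suc i) (suc j) e = P.cong suc (lookup-injective l u i j e)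

map-distinct : ∀ {a₁ a₂ p r} {X : Set a₁} {Y : Set a₂} {Pr : X → Set p} {R : X → X → Set r} (f : X → Y) →
  (∀ {x y} → Pr x → Pr y → R x y → f x P.≢ f y) → ∀ {l} → All Pr l → AllPairs R l → Distinct (L.map f l)
map-distinct f sep []         []         = []
map-distinct f sep (px ∷ pxs) (rx ∷ rxs) = AllP.map⁺ (All.zipWith (λ (py , r) → sep px py r) (pxs , rx)) ∷ map-distinct f sep pxs rxs

module OverField {c ℓ : Level} (F : Field c ℓ) where
  open Field F hiding (zero)
  open FieldDefs F
  open import Relation.Binary.Reasoning.Setoid setoid
  open IntegerSolver commutativeRing using (solve; _:=_; _:+_; _:*_; _:-_; :-_; :1; :0)
  open import Algebra.Properties.Ring ring using (-0#≈0#; -‿involutive)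
  open import Algebra.Properties.Group +-group using (x∙y⁻¹≈ε⇒x≈y)

  nonzero-cancel : ∀ {x z} → x ≉ 0# → x * z ≈ 0# → z ≈ 0#
  nonzero-cancel {x} {z} x≉0 xz≈0 = begin
    z                ≈⟨ solve 3 (λ z x y → z := (x :* z) :* y :+ z :* (:1 :- x :* y)) refl z x (x ⁻¹) ⟩
    (x * z) * x ⁻¹ + z * (1# - x * x ⁻¹)  ≈⟨ +-cong (*-congʳ xz≈0) (*-congˡ (+-congˡ (-‿cong (⁻¹-inverse x x≉0)))) ⟩
    0# * x ⁻¹ + z * (1# - 1#)             ≈⟨ solve 2 (λ y z → :0 :* y :+ z :* (:1 :- :1) := :0) refl (x ⁻¹) z ⟩
    0#               ∎

  -‿nonzero : ∀ {x} → x ≉ 0# → (- x) ≉ 0#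
  -‿nonzero {x} x≉0 -x≈0 = x≉0 (trans (sym (-‿involutive x)) (trans (-‿cong -x≈0) -0#≈0#))

  -‿zero : ∀ {x} → x ≈ 0# → - x ≈ 0#
  -‿zero x≈0 = trans (-‿cong x≈0) -0#≈0#

  sub-zero⇒≈ : ∀ {x y} → x - y ≈ 0# → x ≈ y
  sub-zero⇒≈ {x} {y} = x∙y⁻¹≈ε⇒x≈y x y

  ⁻¹-unique : ∀ {x y} → x ≉ 0# → x * y ≈ 1# → y ≈ x ⁻¹
  ⁻¹-unique {x} {y} x≉0 xy≈1 = sub-zero⇒≈ (nonzero-cancel x≉0 (begin
    x * (y - x ⁻¹)       ≈⟨ solve 3 (λ x y z → x :* (y :- z) := x :* y :- x :* z) refl x y (x ⁻¹) ⟩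
    x * y - x * x ⁻¹     ≈⟨ +-cong xy≈1 (-‿cong (⁻¹-inverse x x≉0)) ⟩
    1# - 1#              ≈⟨ -‿inverseʳ 1# ⟩
    0#                   ∎))

  ⁻¹-cong : ∀ {x y} → x ≉ 0# → x ≈ y → x ⁻¹ ≈ y ⁻¹
  ⁻¹-cong x≉0 x≈y = ⁻¹-unique (λ y≈0 → x≉0 (trans x≈y y≈0)) (trans (*-congʳ (sym x≈y)) (⁻¹-inverse _ x≉0))

  ⁻¹-‿ : ∀ {x} → x ≉ 0# → (- x) ⁻¹ ≈ - (x ⁻¹)
  ⁻¹-‿ {x} x≉0 = sym (⁻¹-unique (-‿nonzero x≉0)
    (trans (solve 2 (λ x y → (:- x) :* (:- y) := x :* y) refl x (x ⁻¹)) (⁻¹-inverse x x≉0)))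

  factor-through : ∀ {x} y → x ≉ 0# → y ≈ x * (y * x ⁻¹)
  factor-through {x} y x≉0 = begin
    y                   ≈⟨ solve 1 (λ y → y := y :* :1) refl y ⟩
    y * 1#              ≈⟨ *-congˡ (sym (⁻¹-inverse x x≉0)) ⟩
    y * (x * x ⁻¹)      ≈⟨ solve 3 (λ y x z → y :* (x :* z) := x :* (y :* z)) refl y x (x ⁻¹) ⟩
    x * (y * x ⁻¹)      ∎

  open import Algebra.Properties.Semiring.Sum semiring
    using (sum; sum-replicate-zero; ∑-distrib-+; ∑-comm; *-distribˡ-sum)

  -- sumFin unfolds exactly like the library's sum, so the library's lemmas apply
  sumFin≡sum : ∀ {m} (f : Fin m → Carrier) → sumFin f P.≡ sum f
  sumFin≡sum {zero}  f = P.refl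
  sumFin≡sum {suc m} f = P.cong (f zero +_) (sumFin≡sum (λ i → f (suc i)))

  via-sum : ∀ {m n} {f : Fin m → Carrier} {g : Fin n → Carrier} → sum f ≈ sum g → sumFin f ≈ sumFin g
  via-sum {f = f} {g} e = trans (reflexive (sumFin≡sum f)) (trans e (reflexive (P.sym (sumFin≡sum g))))

  sumFin-cong : ∀ {m} {f g : Fin m → Carrier} → (∀ i → f i ≈ g i) → sumFin f ≈ sumFin g
  sumFin-cong {zero}  h = refl
  sumFin-cong {suc m} h = +-cong (h zero) (sumFin-cong (λ i → h (suc i)))

  sumFin-+ : ∀ {m} (f g : Fin m → Carrier) → sumFin (λ i → f i + g i) ≈ sumFin f + sumFin g
  sumFin-+ f g = trans (reflexive (sumFin≡sum (λ i → f i + g i))) (trans (∑-distrib-+ f g)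
                   (sym (+-cong (reflexive (sumFin≡sum f)) (reflexive (sumFin≡sum g)))))

  sumFin-scale : ∀ {m} (a : Carrier) (f : Fin m → Carrier) → sumFin (λ i → a * f i) ≈ a * sumFin f
  sumFin-scale a f = trans (reflexive (sumFin≡sum (λ i → a * f i))) (trans (sym (*-distribˡ-sum a f))
                       (*-congˡ (reflexive (P.sym (sumFin≡sum f)))))

  sumFin-‿ : ∀ {m} (f : Fin m → Carrier) → sumFin (λ i → - f i) ≈ - sumFin f
  sumFin-‿ f = begin
    sumFin (λ i → - f i)          ≈⟨ sumFin-cong (λ i → solve 1 (λ x → :- x := (:- :1) :* x) refl (f i)) ⟩
    sumFin (λ i → (- 1#) * f i)   ≈⟨ sumFin-scale (- 1#) f ⟩
    (- 1#) * sumFin f             ≈⟨ solve 1 (λ x → (:- :1) :* x := :- x) refl (sumFin f) ⟩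
    - sumFin f                    ∎

  sumFin-zero : ∀ {m} {f : Fin m → Carrier} → (∀ i → f i ≈ 0#) → sumFin f ≈ 0#
  sumFin-zero {m} h = trans (sumFin-cong h) (trans (reflexive (sumFin≡sum {m} (λ _ → 0#))) (sum-replicate-zero m))

  sumFin-swap : ∀ {m n} (f : Fin m → Fin n → Carrier) →
    sumFin (λ i → sumFin (λ j → f i j)) ≈ sumFin (λ j → sumFin (λ i → f i j))
  sumFin-swap f = begin
    sumFin (λ i → sumFin (λ j → f i j))   ≈⟨ sumFin-cong (λ i → reflexive (sumFin≡sum (f i))) ⟩
    sumFin (λ i → sum (λ j → f i j))      ≈⟨ via-sum {f = λ i → sum (f i)} {g = λ j → sum (λ i → f i j)} (∑-comm f) ⟩
    sumFin (λ j → sum (λ i → f i j))      ≈⟨ sumFin-cong (λ j → reflexive (P.sym (sumFin≡sum (λ i → f i j)))) ⟩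
    sumFin (λ j → sumFin (λ i → f i j))   ∎

  δ : ∀ {m} → Fin m → Fin m → Carrier
  δ zero    zero    = 1#
  δ zero    (suc j) = 0#
  δ (suc i) zero    = 0#
  δ (suc i) (suc j) = δ i j

  δ-sym : ∀ {m} (i j : Fin m) → δ i j P.≡ δ j i
  δ-sym zero    zero    = P.refl
  δ-sym zero    (suc j) = P.refl
  δ-sym (suc i) zero    = P.refl
  δ-sym (suc i) (suc j) = δ-sym i j

  δ-punchIn : ∀ {m} (i : Fin (suc m)) (j : Fin m) → δ i (punchIn i j) ≈ 0#
  δ-punchIn zero    j       = refl
  δ-punchIn (suc i) zero    = refl
  δ-punchIn (suc i) (suc j) = δ-punchIn i j

  sumFin-δ : ∀ {m} (i : Fin m) (g : Fin m → Carrier) → sumFin (λ j → δ i j * g j) ≈ g i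
  sumFin-δ {suc m} zero    g = begin
    1# * g zero + sumFin (λ j → 0# * g (suc j))  ≈⟨ +-cong (*-identityˡ (g zero)) (sumFin-zero (λ j → zeroˡ (g (suc j)))) ⟩
    g zero + 0#                                  ≈⟨ +-identityʳ _ ⟩
    g zero                                       ∎
  sumFin-δ {suc m} (suc i) g = trans (+-cong (zeroˡ _) (sumFin-δ i (λ j → g (suc j)))) (+-identityˡ _)

  unit : ∀ {k} → Fin k → Vec k
  unit l = δ l

  lincomb-linear : ∀ {m k} (α β : Carrier) (u w : Fin m → Carrier) (v : Fin m → Vec k) t →
    lincomb (λ l → α * u l + β * w l) v t ≈ α * lincomb u v t + β * lincomb w v t
  lincomb-linear α β u w v t = begin
    sumFin (λ l → (α * u l + β * w l) * v l t)                           ≈⟨ sumFin-cong (λ l → solve 5 (λ a b x y z → (a :* x :+ b :* y) :* z := a :* (x :* z) :+ b :* (y :* z)) refl α β (u l) (w l) (v l t)) ⟩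
    sumFin (λ l → α * (u l * v l t) + β * (w l * v l t))                 ≈⟨ sumFin-+ (λ l → α * (u l * v l t)) (λ l → β * (w l * v l t)) ⟩
    sumFin (λ l → α * (u l * v l t)) + sumFin (λ l → β * (w l * v l t))  ≈⟨ +-cong (sumFin-scale α (λ l → u l * v l t)) (sumFin-scale β (λ l → w l * v l t)) ⟩
    α * lincomb u v t + β * lincomb w v t                                ∎

  lincomb-unique : ∀ {m k} (v : Fin m → Vec k) → LinIndep v → ∀ {u w x} →
    lincomb u v ≈ᵥ x → lincomb w v ≈ᵥ x → ∀ i → u i ≈ w i
  lincomb-unique v indep {u} {w} {x} u↦x w↦x i =
    sub-zero⇒≈ (trans (solve 2 (λ a b → a :- b := :1 :* a :+ (:- :1) :* b) refl (u i) (w i)) (indep _ difference i))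
    where
    difference : lincomb (λ l → 1# * u l + (- 1#) * w l) v ≈ᵥ 0ᵥ
    difference t = begin
      lincomb (λ l → 1# * u l + (- 1#) * w l) v t        ≈⟨ lincomb-linear 1# (- 1#) u w v t ⟩
      1# * lincomb u v t + (- 1#) * lincomb w v t        ≈⟨ +-cong (*-congˡ (u↦x t)) (*-congˡ (w↦x t)) ⟩
      1# * x t + (- 1#) * x t                            ≈⟨ solve 1 (λ y → :1 :* y :+ (:- :1) :* y := :0) refl (x t) ⟩
      0#                                                 ∎

  lincomb-δ : ∀ {m k} (i : Fin m) (v : Fin m → Vec k) → lincomb (δ i) v ≈ᵥ v i
  lincomb-δ i v j = sumFin-δ i (λ l → v l j)

  apply-unit : ∀ {k} (β : Vec k) l → apply β (unit l) ≈ β l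
  apply-unit β l = trans (sumFin-cong (λ j → *-comm (β j) (δ l j))) (sumFin-δ l β)

  apply-cong : ∀ {k} (β : Vec k) {x y : Vec k} → x ≈ᵥ y → apply β x ≈ apply β y
  apply-cong β e = sumFin-cong (λ j → *-congˡ (e j))

  apply-lincomb : ∀ {m k} (β : Vec k) (a : Fin m → Carrier) (v : Fin m → Vec k) →
    apply β (lincomb a v) ≈ sumFin (λ i → a i * apply β (v i))
  apply-lincomb β a v = begin
    sumFin (λ j → β j * sumFin (λ i → a i * v i j))       ≈⟨ sumFin-cong (λ j → sym (sumFin-scale (β j) (λ i → a i * v i j))) ⟩
    sumFin (λ j → sumFin (λ i → β j * (a i * v i j)))     ≈⟨ sumFin-swap (λ j i → β j * (a i * v i j)) ⟩
    sumFin (λ i → sumFin (λ j → β j * (a i * v i j)))     ≈⟨ sumFin-cong (λ i → sumFin-cong (λ j → solve 3 (λ x y z → x :* (y :* z) := y :* (x :* z)) refl (β j) (a i) (v i j))) ⟩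
    sumFin (λ i → sumFin (λ j → a i * (β j * v i j)))     ≈⟨ sumFin-cong (λ i → sumFin-scale (a i) (λ j → β j * v i j)) ⟩
    sumFin (λ i → a i * apply β (v i))                    ∎

  -- Determinants of matrices whose rows from the third on are unit rows

  term-zeroˡ : ∀ s a d → a ≈ 0# → s * (a * d) ≈ 0#
  term-zeroˡ s a d a≈0 = trans (*-congˡ (trans (*-congʳ a≈0) (zeroˡ d))) (zeroʳ s)

  term-zeroʳ : ∀ s a d → d ≈ 0# → s * (a * d) ≈ 0#
  term-zeroʳ s a d d≈0 = trans (*-congˡ (trans (*-congˡ d≈0) (zeroʳ a))) (zeroʳ s)

  det-zero-row : ∀ {m} (M : Fin m → Vec m) (r : Fin m) → (∀ j → M r j ≈ 0#) → det M ≈ 0#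
  det-zero-row {suc m} M zero    h = sumFin-zero (λ j → term-zeroˡ (sgn j) (M zero j) (det (minor j)) (h j))
    where
    minor : Fin (suc m) → Fin m → Vec m
    minor j r col = M (suc r) (punchIn j col)
  det-zero-row {suc m} M (suc r) h = sumFin-zero (λ j → term-zeroʳ (sgn j) (M zero j) (det (minor j)) (det-zero-row (minor j) r (λ col → h (punchIn j col))))
    where
    minor : Fin (suc m) → Fin m → Vec m
    minor j r col = M (suc r) (punchIn j col)

  private
    expansion-tail : ∀ {m t} (M : Fin (suc m) → Vec (suc m)) (start : Fin t → Fin (suc m)) →
      (∀ j → det (λ r col → M (suc r) (punchIn (start j) col)) ≈ 0#) →
      sumFin (λ j → sgn (start j) * (M zero (start j) * det (λ r col → M (suc r) (punchIn (start j) col)))) ≈ 0#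
    expansion-tail M start h = sumFin-zero (λ j → term-zeroʳ (sgn (start j)) (M zero (start j)) _ (h j))

  det-unit-rows₁ : ∀ {m} (M : Fin (suc m) → Vec (suc m)) → (∀ r col → M (suc r) col ≈ δ (suc r) col) → det M ≈ M zero zero
  det-unit-rows₁ {zero}  M h = solve 1 (λ x → :1 :* (x :* :1) :+ :0 := x) refl (M zero zero)
  det-unit-rows₁ {suc m} M h = begin
    1# * (M zero zero * det (minor zero)) + sumFin (λ j → sgn (suc j) * (M zero (suc j) * det (minor (suc j))))
      ≈⟨ +-cong (*-congˡ (*-congˡ minor₀)) (expansion-tail M suc minorⱼ) ⟩
    1# * (M zero zero * 1#) + 0#   ≈⟨ solve 1 (λ x → :1 :* (x :* :1) :+ :0 := x) refl (M zero zero) ⟩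
    M zero zero                    ∎
    where
    minor : Fin (suc (suc m)) → Fin (suc m) → Vec (suc m)
    minor j r col = M (suc r) (punchIn j col)
    minor₀ : det (minor zero) ≈ 1#
    minor₀ = trans (det-unit-rows₁ (minor zero) (λ r col → h (suc r) (suc col))) (h zero (suc zero))
    minorⱼ : ∀ j → det (minor (suc j)) ≈ 0#
    minorⱼ j = det-zero-row (minor (suc j)) j (λ col → trans (h j (punchIn (suc j) col)) (δ-punchIn (suc j) col))

  det₂ : Carrier × Carrier → Carrier × Carrier → Carrier
  det₂ (u₀ , u₁) (v₀ , v₁) = u₀ * v₁ - u₁ * v₀

  det₂-anti : ∀ u v → det₂ v u ≈ - det₂ u v
  det₂-anti (u₀ , u₁) (v₀ , v₁) = solve 4 (λ u₀ u₁ v₀ v₁ → v₀ :* u₁ :- v₁ :* u₀ := :- (u₀ :* v₁ :- u₁ :* v₀)) refl u₀ u₁ v₀ v₁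

  det₂-congˡ : ∀ {u u'} w → proj₁ u ≈ proj₁ u' → proj₂ u ≈ proj₂ u' → det₂ u w ≈ det₂ u' w
  det₂-congˡ w e₀ e₁ = +-cong (*-congʳ e₀) (-‿cong (*-congʳ e₁))

  det-unit-rows₂ : ∀ {m} (M : Fin (suc (suc m)) → Vec (suc (suc m))) →
    (∀ r col → M (suc (suc r)) col ≈ δ (suc (suc r)) col) →
    det M ≈ det₂ (M zero zero , M zero (suc zero)) (M (suc zero) zero , M (suc zero) (suc zero))
  det-unit-rows₂ {m} M h = begin
    1# * (M zero zero * det (minor zero)) + (- 1# * (M zero (suc zero) * det (minor (suc zero))) + sumFin (λ j → sgn (suc (suc j)) * (M zero (suc (suc j)) * det (minor (suc (suc j))))))
      ≈⟨ +-cong (*-congˡ (*-congˡ minor₀)) (+-cong (*-congˡ (*-congˡ minor₁)) (expansion-tail M (λ j → suc (suc j)) minorⱼ)) ⟩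
    1# * (M zero zero * M (suc zero) (suc zero)) + (- 1# * (M zero (suc zero) * M (suc zero) zero) + 0#)
      ≈⟨ solve 4 (λ a b c d → :1 :* (a :* d) :+ (:- :1 :* (b :* c) :+ :0) := a :* d :- b :* c) refl (M zero zero) (M zero (suc zero)) (M (suc zero) zero) (M (suc zero) (suc zero)) ⟩
    det₂ (M zero zero , M zero (suc zero)) (M (suc zero) zero , M (suc zero) (suc zero)) ∎
    where
    minor : Fin (suc (suc m)) → Fin (suc m) → Vec (suc m)
    minor j r col = M (suc r) (punchIn j col)
    minor₀ : det (minor zero) ≈ M (suc zero) (suc zero)
    minor₀ = det-unit-rows₁ (minor zero) (λ r col → h r (suc col))
    minor₁ : det (minor (suc zero)) ≈ M (suc zero) zero
    minor₁ = det-unit-rows₁ (minor (suc zero)) (λ r col → trans (h r (punchIn (suc zero) col)) (reflexive (δ-skip r col)))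
      where
      δ-skip : ∀ {m} (r : Fin m) (col : Fin (suc m)) → δ (suc (suc r)) (punchIn (suc zero) col) P.≡ δ (suc r) col
      δ-skip r zero      = P.refl
      δ-skip r (suc col) = P.refl
    minorⱼ : ∀ j → det (minor (suc (suc j))) ≈ 0#
    minorⱼ j = det-zero-row (minor (suc (suc j))) (suc j) (λ col → trans (h j (punchIn (suc (suc j)) col)) (δ-punchIn (suc (suc j)) col))

  module ΣS = SubsetFold +-commutativeMonoid
  module ΠS = SubsetFold *-commutativeMonoid

  sumOver-scale : ∀ {N} (p : Subset N) (x : Carrier) (g : Fin N → Carrier) → sumOver p (λ i → x * g i) ≈ x * sumOver p g
  sumOver-scale {zero}  V.[]          x g = sym (zeroʳ x)
  sumOver-scale {suc N} (true V.∷ p)  x g = begin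
    sumOver (true V.∷ p) (λ i → x * g i)            ≡⟨ ΣS.fold-inside p (λ i → x * g i) ⟩
    x * g zero + sumOver p (λ i → x * g (suc i))    ≈⟨ +-congˡ (sumOver-scale p x (λ i → g (suc i))) ⟩
    x * g zero + x * sumOver p (λ i → g (suc i))    ≈⟨ distribˡ x _ _ ⟨
    x * (g zero + sumOver p (λ i → g (suc i)))      ≡⟨ P.cong (x *_) (ΣS.fold-inside p g) ⟨
    x * sumOver (true V.∷ p) g                      ∎
  sumOver-scale {suc N} (false V.∷ p) x g = begin
    sumOver (false V.∷ p) (λ i → x * g i)           ≡⟨ ΣS.fold-outside p (λ i → x * g i) ⟩
    sumOver p (λ i → x * g (suc i))                 ≈⟨ sumOver-scale p x (λ i → g (suc i)) ⟩
    x * sumOver p (λ i → g (suc i))                 ≡⟨ P.cong (x *_) (ΣS.fold-outside p g) ⟨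
    x * sumOver (false V.∷ p) g                     ∎

  sumOver-sub : ∀ {N} (p : Subset N) (g h : Fin N → Carrier) → sumOver p (λ i → g i - h i) ≈ sumOver p g - sumOver p h
  sumOver-sub p g h = begin
    sumOver p (λ i → g i - h i)                   ≈⟨ ΣS.fold-cong p (λ i _ → +-congˡ (solve 1 (λ x → :- x := (:- :1) :* x) refl (h i))) ⟩
    sumOver p (λ i → g i + (- 1#) * h i)          ≈⟨ ΣS.fold-∙ p g (λ i → (- 1#) * h i) ⟩
    sumOver p g + sumOver p (λ i → (- 1#) * h i)  ≈⟨ +-congˡ (sumOver-scale p (- 1#) h) ⟩
    sumOver p g + (- 1#) * sumOver p h            ≈⟨ +-congˡ (solve 1 (λ x → (:- :1) :* x := :- x) refl (sumOver p h)) ⟩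
    sumOver p g - sumOver p h                     ∎

  sumOver-singleton : ∀ {N} (c : Fin N) (g : Fin N → Carrier) → sumOver ⁅ c ⁆ g ≈ g c
  sumOver-singleton c g = trans (ΣS.fold-split ⁅ c ⁆ g (SubP.x∈⁅x⁆ c)) (trans (+-congˡ (ΣS.fold-empty (⁅ c ⁆ ─ ⁅ c ⁆) g empty)) (+-identityʳ _))
    where
    empty : ∣ ⁅ c ⁆ ─ ⁅ c ⁆ ∣ P.≡ 0
    empty = ℕP.suc-injective (P.trans (P.sym (size-remove ⁅ c ⁆ (SubP.x∈⁅x⁆ c))) (SubP.∣⁅x⁆∣≡1 c))

  -- For pairwise independent points p_c ∈ F²
  -- (c ∈ D) and a list ws of vectors with |D| = |ws| + 2,
  --   Σ_{c ∈ D} Π_{w ∈ ws} det₂(p_c , w) · Π_{y ∈ D ∖ c} det₂(p_c , p_y)⁻¹ = 0 .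
  -- (Homogeneous Lagrange interpolation: a binary form of degree |ws| is
  -- determined by its values at |ws| + 1 points.)  Induction on ws: for
  -- a ≠ b in D, multiplying the sum by det₂(p_a , p_b) expresses it through
  -- the sums for D ∖ a and D ∖ b with one vector fewer.

  module Interpolation {N : ℕ} (pt : Fin N → Carrier × Carrier) where

    Independent : Subset N → Set ℓ
    Independent D = ∀ {x y} → x ∈ D → y ∈ D → x P.≢ y → det₂ (pt x) (pt y) ≉ 0#

    numerator : List (Carrier × Carrier) → Fin N → Carrier
    numerator ws c = L.foldr (λ w r → det₂ (pt c) w * r) 1# ws

    inv : Fin N → Fin N → Carrier
    inv c y = det₂ (pt c) (pt y) ⁻¹

    term : Subset N → List (Carrier × Carrier) → Fin N → Carrier
    term D ws c = numerator ws c * prodOver (D ─ ⁅ c ⁆) (inv c)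

    interpolationSum : Subset N → List (Carrier × Carrier) → Carrier
    interpolationSum D ws = sumOver D (term D ws)

    inv-inverse : ∀ {D c y} → Independent D → c ∈ D → y ∈ D → c P.≢ y → det₂ (pt c) (pt y) * inv c y ≈ 1#
    inv-inverse ind c∈D y∈D c≢y = ⁻¹-inverse _ (ind c∈D y∈D c≢y)

    -- two points: the terms are  det₂(p_a,p_b)⁻¹  and  det₂(p_b,p_a)⁻¹ = −det₂(p_a,p_b)⁻¹
    two-points : ∀ D {a b} → Independent D → a ∈ D → b ∈ D ─ ⁅ a ⁆ → ∣ D ─ ⁅ a ⁆ ─ ⁅ b ⁆ ∣ P.≡ 0 →
      interpolationSum D [] ≈ 0#
    two-points D {a} {b} ind a∈D b∈D-a rest-empty = begin
      sumOver D (term D [])                                         ≈⟨ ΣS.fold-split D (term D []) a∈D ⟩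
      term D [] a + sumOver (D ─ ⁅ a ⁆) (term D [])                 ≈⟨ +-congˡ (ΣS.fold-split (D ─ ⁅ a ⁆) (term D []) b∈D-a) ⟩
      term D [] a + (term D [] b + sumOver (D ─ ⁅ a ⁆ ─ ⁅ b ⁆) (term D []))
        ≈⟨ +-cong at-a (+-cong at-b (ΣS.fold-empty (D ─ ⁅ a ⁆ ─ ⁅ b ⁆) (term D []) rest-empty)) ⟩
      x ⁻¹ + (- (x ⁻¹) + 0#)                                        ≈⟨ solve 1 (λ y → y :+ (:- y :+ :0) := :0) refl (x ⁻¹) ⟩
      0#                                                            ∎
      where
      b∈D = proj₁ (∈-remove⁻ b∈D-a)
      b≢a = proj₂ (∈-remove⁻ b∈D-a)
      a∈D-b : a ∈ D ─ ⁅ b ⁆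
      a∈D-b = SubP.x∈p∧x≢y⇒x∈p-y a∈D (λ e → b≢a (P.sym e))
      x = det₂ (pt a) (pt b)
      x≉0 : x ≉ 0#
      x≉0 = ind a∈D b∈D (λ e → b≢a (P.sym e))
      only : ∀ c d → c ∈ D → d ∈ D ─ ⁅ c ⁆ → ∣ D ─ ⁅ c ⁆ ─ ⁅ d ⁆ ∣ P.≡ 0 → term D [] c ≈ inv c d
      only c d c∈D d∈D-c empty = begin
        1# * prodOver (D ─ ⁅ c ⁆) (inv c)               ≈⟨ *-identityˡ _ ⟩
        prodOver (D ─ ⁅ c ⁆) (inv c)                    ≈⟨ ΠS.fold-split (D ─ ⁅ c ⁆) (inv c) d∈D-c ⟩
        inv c d * prodOver (D ─ ⁅ c ⁆ ─ ⁅ d ⁆) (inv c)   ≈⟨ *-congˡ (ΠS.fold-empty (D ─ ⁅ c ⁆ ─ ⁅ d ⁆) (inv c) empty) ⟩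
        inv c d * 1#                                    ≈⟨ *-identityʳ _ ⟩
        inv c d                                         ∎
      at-a : term D [] a ≈ x ⁻¹
      at-a = only a b a∈D b∈D-a rest-empty
      at-b : term D [] b ≈ - (x ⁻¹)
      at-b = begin
        term D [] b                    ≈⟨ only b a b∈D a∈D-b (P.trans (P.cong ∣_∣ (SubP.p─x─y≡p─y─x D b a)) rest-empty) ⟩
        det₂ (pt b) (pt a) ⁻¹          ≈⟨ ⁻¹-cong (-‿nonzero x≉0) (sym (det₂-anti (pt a) (pt b))) ⟨
        (- x) ⁻¹                       ≈⟨ ⁻¹-‿ x≉0 ⟩
        - (x ⁻¹)                       ∎

    module Step (w : Carrier × Carrier) (ws : List (Carrier × Carrier)) (D : Subset N) (ind : Independent D)
                {a b : Fin N} (a∈D : a ∈ D) (b∈D-a : b ∈ D ─ ⁅ a ⁆) where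
      b∈D = proj₁ (∈-remove⁻ b∈D-a)
      b≢a = proj₂ (∈-remove⁻ b∈D-a)
      a∈D-b : a ∈ D ─ ⁅ b ⁆
      a∈D-b = SubP.x∈p∧x≢y⇒x∈p-y a∈D (λ e → b≢a (P.sym e))
      Dᵃ = D ─ ⁅ a ⁆
      Dᵇ = D ─ ⁅ b ⁆
      Dᵃᵇ = D ─ ⁅ a ⁆ ─ ⁅ b ⁆
      x = det₂ (pt a) (pt b)
      wa = det₂ w (pt a)
      wb = det₂ w (pt b)
      T = term D (w ∷ ws)
      Tᵃ = term Dᵃ ws
      Tᵇ = term Dᵇ ws

      at-a : x * T a ≈ - wa * Tᵇ a
      at-a = begin
        x * ((det₂ (pt a) w * numerator ws a) * prodOver Dᵃ (inv a))               ≈⟨ *-congˡ (*-congˡ (ΠS.fold-split Dᵃ (inv a) b∈D-a)) ⟩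
        x * ((det₂ (pt a) w * numerator ws a) * (inv a b * prodOver Dᵃᵇ (inv a)))  ≈⟨ solve 5 (λ x u g y r → x :* ((u :* g) :* (y :* r)) := (x :* y) :* (u :* (g :* r))) refl x (det₂ (pt a) w) (numerator ws a) (inv a b) (prodOver Dᵃᵇ (inv a)) ⟩
        (x * inv a b) * (det₂ (pt a) w * (numerator ws a * prodOver Dᵃᵇ (inv a)))  ≈⟨ *-congʳ (inv-inverse ind a∈D b∈D (λ e → b≢a (P.sym e))) ⟩
        1# * (det₂ (pt a) w * (numerator ws a * prodOver Dᵃᵇ (inv a)))             ≈⟨ *-identityˡ _ ⟩
        det₂ (pt a) w * (numerator ws a * prodOver Dᵃᵇ (inv a))                    ≈⟨ *-cong (det₂-anti w (pt a)) (*-congˡ (reflexive (P.cong (λ z → prodOver z (inv a)) (SubP.p─x─y≡p─y─x D a b)))) ⟩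
        - wa * Tᵇ a                                                               ∎

      at-b : x * T b ≈ wb * Tᵃ b
      at-b = begin
        x * ((det₂ (pt b) w * numerator ws b) * prodOver Dᵇ (inv b))                   ≈⟨ *-congˡ (*-congˡ (ΠS.fold-split Dᵇ (inv b) a∈D-b)) ⟩
        x * ((det₂ (pt b) w * numerator ws b) * (inv b a * prodOver (Dᵇ ─ ⁅ a ⁆) (inv b)))
          ≈⟨ *-cong (det₂-anti (pt b) (pt a)) (*-cong (*-congʳ (det₂-anti w (pt b))) (*-congˡ (reflexive (P.cong (λ z → prodOver z (inv b)) (SubP.p─x─y≡p─y─x D b a))))) ⟩
        - det₂ (pt b) (pt a) * ((- wb * numerator ws b) * (inv b a * prodOver Dᵃᵇ (inv b)))
          ≈⟨ solve 5 (λ x u g y r → :- x :* ((:- u :* g) :* (y :* r)) := (x :* y) :* (u :* (g :* r))) refl (det₂ (pt b) (pt a)) wb (numerator ws b) (inv b a) (prodOver Dᵃᵇ (inv b)) ⟩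
        (det₂ (pt b) (pt a) * inv b a) * (wb * (numerator ws b * prodOver Dᵃᵇ (inv b)))  ≈⟨ *-congʳ (inv-inverse ind b∈D a∈D b≢a) ⟩
        1# * (wb * Tᵃ b)                                                                ≈⟨ *-identityˡ _ ⟩
        wb * Tᵃ b                                                                       ∎

      elsewhere : ∀ c → c ∈ Dᵃᵇ → x * T c ≈ wb * Tᵃ c - wa * Tᵇ c
      elsewhere c c∈Dᵃᵇ = begin
        x * ((det₂ (pt c) w * g) * prodOver (D ─ ⁅ c ⁆) (inv c))
          ≈⟨ *-congˡ (*-congˡ (trans (ΠS.fold-split (D ─ ⁅ c ⁆) (inv c) a∈D-c) (*-congˡ (ΠS.fold-split (D ─ ⁅ c ⁆ ─ ⁅ a ⁆) (inv c) b∈D-c-a)))) ⟩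
        x * ((det₂ (pt c) w * g) * (inv c a * (inv c b * R)))
          ≈⟨ expand ⟩
        wb * (g * (inv c b * R)) * (det₂ (pt c) (pt a) * inv c a) - wa * (g * (inv c a * R)) * (det₂ (pt c) (pt b) * inv c b)
          ≈⟨ +-cong (*-congˡ (inv-inverse ind c∈D a∈D c≢a)) (-‿cong (*-congˡ (inv-inverse ind c∈D b∈D c≢b))) ⟩
        wb * (g * (inv c b * R)) * 1# - wa * (g * (inv c a * R)) * 1#
          ≈⟨ +-cong (*-identityʳ _) (-‿cong (*-identityʳ _)) ⟩
        wb * (g * (inv c b * R)) - wa * (g * (inv c a * R))
          ≈⟨ +-cong (*-congˡ (*-congˡ (sym (trans (ΠS.fold-split (Dᵃ ─ ⁅ c ⁆) (inv c) b∈Dᵃ-c) (*-congˡ (reflexive (P.cong (λ z → prodOver z (inv c)) Dᵃ-c-b))))))) (-‿cong (*-congˡ (*-congˡ (sym (trans (ΠS.fold-split (Dᵇ ─ ⁅ c ⁆) (inv c) a∈Dᵇ-c) (*-congˡ (reflexive (P.cong (λ z → prodOver z (inv c)) Dᵇ-c-a)))))))) ⟩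
        wb * Tᵃ c - wa * Tᵇ c   ∎
        where
        c∈D-a = proj₁ (∈-remove⁻ c∈Dᵃᵇ)
        c≢b = proj₂ (∈-remove⁻ c∈Dᵃᵇ)
        c∈D = proj₁ (∈-remove⁻ c∈D-a)
        c≢a = proj₂ (∈-remove⁻ c∈D-a)
        g = numerator ws c
        R = prodOver (D ─ ⁅ c ⁆ ─ ⁅ a ⁆ ─ ⁅ b ⁆) (inv c)
        a∈D-c : a ∈ D ─ ⁅ c ⁆
        a∈D-c = SubP.x∈p∧x≢y⇒x∈p-y a∈D (λ e → c≢a (P.sym e))
        b∈D-c-a : b ∈ D ─ ⁅ c ⁆ ─ ⁅ a ⁆
        b∈D-c-a = SubP.x∈p∧x≢y⇒x∈p-y (SubP.x∈p∧x≢y⇒x∈p-y b∈D (λ e → c≢b (P.sym e))) b≢a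
        b∈Dᵃ-c : b ∈ Dᵃ ─ ⁅ c ⁆
        b∈Dᵃ-c = SubP.x∈p∧x≢y⇒x∈p-y b∈D-a (λ e → c≢b (P.sym e))
        a∈Dᵇ-c : a ∈ Dᵇ ─ ⁅ c ⁆
        a∈Dᵇ-c = SubP.x∈p∧x≢y⇒x∈p-y a∈D-b (λ e → c≢a (P.sym e))
        Dᵃ-c-b : Dᵃ ─ ⁅ c ⁆ ─ ⁅ b ⁆ P.≡ D ─ ⁅ c ⁆ ─ ⁅ a ⁆ ─ ⁅ b ⁆
        Dᵃ-c-b = P.cong (_─ ⁅ b ⁆) (SubP.p─x─y≡p─y─x D a c)
        Dᵇ-c-a : Dᵇ ─ ⁅ c ⁆ ─ ⁅ a ⁆ P.≡ D ─ ⁅ c ⁆ ─ ⁅ a ⁆ ─ ⁅ b ⁆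
        Dᵇ-c-a = P.trans (P.cong (_─ ⁅ a ⁆) (SubP.p─x─y≡p─y─x D b c)) (SubP.p─x─y≡p─y─x (D ─ ⁅ c ⁆) b a)
        -- the Plücker-type identity  det₂(a,b) det₂(c,w) = det₂(w,b) det₂(c,a) − det₂(w,a) det₂(c,b)
        expand : x * ((det₂ (pt c) w * g) * (inv c a * (inv c b * R)))
               ≈ wb * (g * (inv c b * R)) * (det₂ (pt c) (pt a) * inv c a) - wa * (g * (inv c a * R)) * (det₂ (pt c) (pt b) * inv c b)
        expand = solve 12 (λ a₀ a₁ b₀ b₁ c₀ c₁ w₀ w₁ g iᵃ iᵇ r →
                   (a₀ :* b₁ :- a₁ :* b₀) :* ((c₀ :* w₁ :- c₁ :* w₀) :* g :* (iᵃ :* (iᵇ :* r)))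
                   := (w₀ :* b₁ :- w₁ :* b₀) :* (g :* (iᵇ :* r)) :* ((c₀ :* a₁ :- c₁ :* a₀) :* iᵃ)
                      :- (w₀ :* a₁ :- w₁ :* a₀) :* (g :* (iᵃ :* r)) :* ((c₀ :* b₁ :- c₁ :* b₀) :* iᵇ)) refl
                   (proj₁ (pt a)) (proj₂ (pt a)) (proj₁ (pt b)) (proj₂ (pt b)) (proj₁ (pt c)) (proj₂ (pt c)) (proj₁ w) (proj₂ w) g (inv c a) (inv c b) R

      scaled-sum : x * interpolationSum D (w ∷ ws) ≈ wb * interpolationSum Dᵃ ws - wa * interpolationSum Dᵇ ws
      scaled-sum = begin
        x * sumOver D T                                      ≈⟨ *-congˡ (trans (ΣS.fold-split D T a∈D) (+-congˡ (ΣS.fold-split Dᵃ T b∈D-a))) ⟩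
        x * (T a + (T b + sumOver Dᵃᵇ T))                    ≈⟨ solve 4 (λ x p q r → x :* (p :+ (q :+ r)) := x :* p :+ (x :* q :+ x :* r)) refl x (T a) (T b) (sumOver Dᵃᵇ T) ⟩
        x * T a + (x * T b + x * sumOver Dᵃᵇ T)              ≈⟨ +-cong at-a (+-cong at-b rest) ⟩
        - wa * Tᵇ a + (wb * Tᵃ b + (wb * sumOver Dᵃᵇ Tᵃ - wa * sumOver (Dᵇ ─ ⁅ a ⁆) Tᵇ))
          ≈⟨ solve 6 (λ p q r s t u → :- p :* q :+ (r :* s :+ (r :* t :- p :* u)) := r :* (s :+ t) :- p :* (q :+ u)) refl wa (Tᵇ a) wb (Tᵃ b) (sumOver Dᵃᵇ Tᵃ) (sumOver (Dᵇ ─ ⁅ a ⁆) Tᵇ) ⟩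
        wb * (Tᵃ b + sumOver Dᵃᵇ Tᵃ) - wa * (Tᵇ a + sumOver (Dᵇ ─ ⁅ a ⁆) Tᵇ)
          ≈⟨ +-cong (*-congˡ (sym (ΣS.fold-split Dᵃ Tᵃ b∈D-a))) (-‿cong (*-congˡ (sym (ΣS.fold-split Dᵇ Tᵇ a∈D-b)))) ⟩
        wb * interpolationSum Dᵃ ws - wa * interpolationSum Dᵇ ws ∎
        where
        rest : x * sumOver Dᵃᵇ T ≈ wb * sumOver Dᵃᵇ Tᵃ - wa * sumOver (Dᵇ ─ ⁅ a ⁆) Tᵇ
        rest = begin
          x * sumOver Dᵃᵇ T                                         ≈⟨ sumOver-scale Dᵃᵇ x T ⟨
          sumOver Dᵃᵇ (λ c → x * T c)                               ≈⟨ ΣS.fold-cong Dᵃᵇ elsewhere ⟩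
          sumOver Dᵃᵇ (λ c → wb * Tᵃ c - wa * Tᵇ c)                ≈⟨ sumOver-sub Dᵃᵇ (λ c → wb * Tᵃ c) (λ c → wa * Tᵇ c) ⟩
          sumOver Dᵃᵇ (λ c → wb * Tᵃ c) - sumOver Dᵃᵇ (λ c → wa * Tᵇ c)
            ≈⟨ +-cong (sumOver-scale Dᵃᵇ wb Tᵃ) (-‿cong (trans (reflexive (P.cong (λ z → sumOver z (λ c → wa * Tᵇ c)) (SubP.p─x─y≡p─y─x D a b))) (sumOver-scale (Dᵇ ─ ⁅ a ⁆) wa Tᵇ))) ⟩
          wb * sumOver Dᵃᵇ Tᵃ - wa * sumOver (Dᵇ ─ ⁅ a ⁆) Tᵇ      ∎

    module TwoMembers (D : Subset N) {n : ℕ} (size : ∣ D ∣ P.≡ suc (suc n)) where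
      a = proj₁ (member D size)
      a∈D = proj₂ (member D size)
      size-a : ∣ D ─ ⁅ a ⁆ ∣ P.≡ suc n
      size-a = ℕP.suc-injective (P.trans (P.sym (size-remove D a∈D)) size)
      b = proj₁ (member (D ─ ⁅ a ⁆) size-a)
      b∈D-a = proj₂ (member (D ─ ⁅ a ⁆) size-a)
      size-b : ∣ D ─ ⁅ b ⁆ ∣ P.≡ suc n
      size-b = ℕP.suc-injective (P.trans (P.sym (size-remove D (proj₁ (∈-remove⁻ b∈D-a)))) size)
      size-ab : ∣ D ─ ⁅ a ⁆ ─ ⁅ b ⁆ ∣ P.≡ n
      size-ab = ℕP.suc-injective (P.trans (P.sym (size-remove (D ─ ⁅ a ⁆) b∈D-a)) size-a)

    shrink : ∀ {D} c → Independent D → Independent (D ─ ⁅ c ⁆)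
    shrink c ind x∈ y∈ = ind (proj₁ (∈-remove⁻ x∈)) (proj₁ (∈-remove⁻ y∈))

    interpolation : ∀ ws (D : Subset N) → Independent D → ∣ D ∣ P.≡ suc (suc (L.length ws)) → interpolationSum D ws ≈ 0#
    interpolation []       D ind size = two-points D ind a∈D b∈D-a size-ab
      where open TwoMembers D size
    interpolation (w ∷ ws) D ind size = nonzero-cancel x≉0 (begin
      x * interpolationSum D (w ∷ ws)                                  ≈⟨ scaled-sum ⟩
      wb * interpolationSum Dᵃ ws - wa * interpolationSum Dᵇ ws       ≈⟨ +-cong (*-congˡ IHᵃ) (-‿cong (*-congˡ IHᵇ)) ⟩
      wb * 0# - wa * 0#                                                ≈⟨ solve 2 (λ p q → p :* :0 :- q :* :0 := :0) refl wb wa ⟩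
      0#                                                               ∎)
      where
      open TwoMembers D size
      open Step w ws D ind a∈D b∈D-a
      x≉0 : x ≉ 0#
      x≉0 = ind a∈D b∈D (λ e → b≢a (P.sym e))
      IHᵃ = interpolation ws Dᵃ (shrink a ind) size-a
      IHᵇ = interpolation ws Dᵇ (shrink b ind) size-b

  -- The plane F² over a finite field and its q + 1 directions

  NonZero₂ : Carrier × Carrier → Set ℓ
  NonZero₂ u = ¬ ((proj₁ u ≈ 0#) × (proj₂ u ≈ 0#))

  Relation : Carrier × Carrier → Carrier × Carrier → Set (c Level.⊔ ℓ)
  Relation (u₀ , u₁) (v₀ , v₁) = Σ Carrier λ α → Σ Carrier λ β →
    (α * u₀ + β * v₀ ≈ 0#) × (α * u₁ + β * v₁ ≈ 0#) × ((α ≉ 0#) ⊎ (β ≉ 0#))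

  module FiniteField (q : ℕ) (order : HasOrder q) where
    enum = proj₁ order
    enum-injective = proj₁ (proj₂ order)

    index : Carrier → Fin q
    index x = proj₁ (proj₂ (proj₂ order) x)

    enum-index : ∀ x → x ≈ enum (index x)
    enum-index x = proj₂ (proj₂ (proj₂ order) x)

    _≟_ : ∀ x y → Dec (x ≈ y)
    x ≟ y with index x FinP.≟ index y
    ... | yes same = yes (trans (enum-index x) (trans (reflexive (P.cong enum same)) (sym (enum-index y))))
    ... | no differ = no (λ x≈y → differ (enum-injective _ _ (trans (sym (enum-index x)) (trans x≈y (enum-index y)))))

    zero? : ∀ x → Dec (x ≈ 0#)
    zero? x = x ≟ 0#

    dependent : ∀ u v → det₂ u v ≈ 0# → Relation u v
    dependent (u₀ , u₁) (v₀ , v₁) det≈0 = choose (zero? u₀) (zero? u₁)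
      where
      choose : Dec (u₀ ≈ 0#) → Dec (u₁ ≈ 0#) → Relation (u₀ , u₁) (v₀ , v₁)
      choose (no u₀≉0) _ = v₀ , - u₀ ,
        solve 2 (λ u₀ v₀ → v₀ :* u₀ :+ (:- u₀) :* v₀ := :0) refl u₀ v₀ ,
        trans (solve 4 (λ u₀ u₁ v₀ v₁ → v₀ :* u₁ :+ (:- u₀) :* v₁ := :- (u₀ :* v₁ :- u₁ :* v₀)) refl u₀ u₁ v₀ v₁) (-‿zero det≈0) ,
        inj₂ (-‿nonzero u₀≉0)
      choose (yes u₀≈0) (no u₁≉0) = v₁ , - u₁ ,
        trans (solve 4 (λ u₀ u₁ v₀ v₁ → v₁ :* u₀ :+ (:- u₁) :* v₀ := u₀ :* v₁ :- u₁ :* v₀) refl u₀ u₁ v₀ v₁) det≈0 ,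
        solve 2 (λ u₁ v₁ → v₁ :* u₁ :+ (:- u₁) :* v₁ := :0) refl u₁ v₁ ,
        inj₂ (-‿nonzero u₁≉0)
      choose (yes u₀≈0) (yes u₁≈0) = 1# , 0# ,
        trans (+-cong (*-congˡ u₀≈0) (zeroˡ v₀)) (solve 0 (:1 :* :0 :+ :0 := :0) refl) ,
        trans (+-cong (*-congˡ u₁≈0) (zeroˡ v₁)) (solve 0 (:1 :* :0 :+ :0 := :0) refl) ,
        inj₁ (λ 1≈0 → 0≉1 (sym 1≈0))

    collinear-trans : ∀ u B G → NonZero₂ B → det₂ u B ≈ 0# → det₂ G B ≈ 0# → det₂ u G ≈ 0#
    collinear-trans (u₀ , u₁) (B₀ , B₁) (G₀ , G₁) B≠0 uB≈0 GB≈0 with zero? B₀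
    ... | no B₀≉0 = nonzero-cancel B₀≉0 (begin
      B₀ * (u₀ * G₁ - u₁ * G₀)                                 ≈⟨ solve 6 (λ u₀ u₁ b₀ b₁ g₀ g₁ → b₀ :* (u₀ :* g₁ :- u₁ :* g₀) := (u₀ :* b₁ :- u₁ :* b₀) :* g₀ :- (g₀ :* b₁ :- g₁ :* b₀) :* u₀) refl u₀ u₁ B₀ B₁ G₀ G₁ ⟩
      det₂ (u₀ , u₁) (B₀ , B₁) * G₀ - det₂ (G₀ , G₁) (B₀ , B₁) * u₀ ≈⟨ +-cong (*-congʳ uB≈0) (-‿cong (*-congʳ GB≈0)) ⟩
      0# * G₀ - 0# * u₀                                        ≈⟨ solve 2 (λ x y → :0 :* x :- :0 :* y := :0) refl G₀ u₀ ⟩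
      0#                                                       ∎)
    ... | yes B₀≈0 = nonzero-cancel (λ B₁≈0 → B≠0 (B₀≈0 , B₁≈0)) (begin
      B₁ * (u₀ * G₁ - u₁ * G₀)                                 ≈⟨ solve 6 (λ u₀ u₁ b₀ b₁ g₀ g₁ → b₁ :* (u₀ :* g₁ :- u₁ :* g₀) := (u₀ :* b₁ :- u₁ :* b₀) :* g₁ :- (g₀ :* b₁ :- g₁ :* b₀) :* u₁) refl u₀ u₁ B₀ B₁ G₀ G₁ ⟩
      det₂ (u₀ , u₁) (B₀ , B₁) * G₁ - det₂ (G₀ , G₁) (B₀ , B₁) * u₁ ≈⟨ +-cong (*-congʳ uB≈0) (-‿cong (*-congʳ GB≈0)) ⟩
      0# * G₁ - 0# * u₁                                        ≈⟨ solve 2 (λ x y → :0 :* x :- :0 :* y := :0) refl G₁ u₁ ⟩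
      0#                                                       ∎)

    -- the direction ("slope") of a vector: vertical ↦ zero, otherwise u₁/u₀ ↦ suc (index of u₁/u₀)
    slopeOf : ∀ u → Dec (proj₁ u ≈ 0#) → Fin (suc q)
    slopeOf u (yes _) = zero
    slopeOf u (no _)  = suc (index (proj₂ u * proj₁ u ⁻¹))

    slope : Carrier × Carrier → Fin (suc q)
    slope u = slopeOf u (zero? (proj₁ u))

    ratio-collinear : ∀ {u₀ u₁ v₀ v₁} → u₀ ≉ 0# → v₀ ≉ 0# →
      u₁ * u₀ ⁻¹ ≈ v₁ * v₀ ⁻¹ → det₂ (u₀ , u₁) (v₀ , v₁) ≈ 0#
    ratio-collinear {u₀} {u₁} {v₀} {v₁} u₀≉0 v₀≉0 same = begin
      u₀ * v₁ - u₁ * v₀                                     ≈⟨ +-cong (*-congˡ (factor-through v₁ v₀≉0)) (-‿cong (*-congʳ (factor-through u₁ u₀≉0))) ⟩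
      u₀ * (v₀ * (v₁ * v₀ ⁻¹)) - (u₀ * (u₁ * u₀ ⁻¹)) * v₀   ≈⟨ +-congˡ (-‿cong (*-congʳ (*-congˡ same))) ⟩
      u₀ * (v₀ * (v₁ * v₀ ⁻¹)) - (u₀ * (v₁ * v₀ ⁻¹)) * v₀   ≈⟨ solve 3 (λ a b r → a :* (b :* r) :- (a :* r) :* b := :0) refl u₀ v₀ (v₁ * v₀ ⁻¹) ⟩
      0#                                                    ∎

    collinear-ratio : ∀ {u₀ u₁ v₀ v₁} → u₀ ≉ 0# → v₀ ≉ 0# →
      det₂ (u₀ , u₁) (v₀ , v₁) ≈ 0# → u₁ * u₀ ⁻¹ ≈ v₁ * v₀ ⁻¹
    collinear-ratio {u₀} {u₁} {v₀} {v₁} u₀≉0 v₀≉0 det≈0 = begin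
      u₁ * u₀ ⁻¹                        ≈⟨ *-congʳ (factor-through u₁ v₀≉0) ⟩
      (v₀ * (u₁ * v₀ ⁻¹)) * u₀ ⁻¹       ≈⟨ solve 4 (λ a b c d → (a :* (b :* c)) :* d := (b :* a) :* (c :* d)) refl v₀ u₁ (v₀ ⁻¹) (u₀ ⁻¹) ⟩
      (u₁ * v₀) * (v₀ ⁻¹ * u₀ ⁻¹)       ≈⟨ *-congʳ (sym (sub-zero⇒≈ det≈0)) ⟩
      (u₀ * v₁) * (v₀ ⁻¹ * u₀ ⁻¹)       ≈⟨ solve 4 (λ a b c d → (a :* b) :* (c :* d) := (b :* c) :* (a :* d)) refl u₀ v₁ (v₀ ⁻¹) (u₀ ⁻¹) ⟩
      (v₁ * v₀ ⁻¹) * (u₀ * u₀ ⁻¹)       ≈⟨ *-congˡ (⁻¹-inverse u₀ u₀≉0) ⟩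
      (v₁ * v₀ ⁻¹) * 1#                 ≈⟨ *-identityʳ _ ⟩
      v₁ * v₀ ⁻¹                        ∎

    det₂-vertical : ∀ {u₀ u₁ v₀ v₁} → u₀ ≈ 0# → det₂ (u₀ , u₁) (v₀ , v₁) ≈ - (u₁ * v₀)
    det₂-vertical {u₀} {u₁} {v₀} {v₁} u₀≈0 =
      trans (+-congʳ (trans (*-congʳ u₀≈0) (zeroˡ v₁))) (solve 1 (λ x → :0 :+ :- x := :- x) refl (u₁ * v₀))

    slope-collinear : ∀ u v → slope u P.≡ slope v → det₂ u v ≈ 0#
    slope-collinear (u₀ , u₁) (v₀ , v₁) = compare (zero? u₀) (zero? v₀)
      where
      compare : ∀ du dv → slopeOf (u₀ , u₁) du P.≡ slopeOf (v₀ , v₁) dv → det₂ (u₀ , u₁) (v₀ , v₁) ≈ 0#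
      compare (yes u₀≈0) (yes v₀≈0) _ = trans (det₂-vertical u₀≈0) (-‿zero (trans (*-congˡ v₀≈0) (zeroʳ u₁)))
      compare (yes _)    (no _)     ()
      compare (no _)     (yes _)    ()
      compare (no u₀≉0)  (no v₀≉0)  e = ratio-collinear u₀≉0 v₀≉0
        (trans (enum-index _) (trans (reflexive (P.cong enum (FinP.suc-injective e))) (sym (enum-index _))))

    collinear-slope : ∀ u v → NonZero₂ u → NonZero₂ v → det₂ u v ≈ 0# → slope u P.≡ slope v
    collinear-slope (u₀ , u₁) (v₀ , v₁) u≠0 v≠0 det≈0 = compare (zero? u₀) (zero? v₀)
      where
      compare : ∀ du dv → slopeOf (u₀ , u₁) du P.≡ slopeOf (v₀ , v₁) dv
      compare (yes _)    (yes _)    = P.refl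
      compare (yes u₀≈0) (no v₀≉0)  = ⊥-elim (v₀≉0 (nonzero-cancel (λ u₁≈0 → u≠0 (u₀≈0 , u₁≈0))
        (trans (sym (-‿involutive _)) (-‿zero (trans (sym (det₂-vertical u₀≈0)) det≈0)))))
      compare (no u₀≉0)  (yes v₀≈0) = ⊥-elim (u₀≉0 (nonzero-cancel (λ v₁≈0 → v≠0 (v₀≈0 , v₁≈0))
        (trans (sym (-‿involutive _)) (-‿zero (trans (sym (det₂-vertical v₀≈0)) (trans (det₂-anti (u₀ , u₁) (v₀ , v₁)) (-‿zero det≈0)))))))
      compare (no u₀≉0)  (no v₀≉0)  = P.cong suc (enum-injective _ _
        (trans (sym (enum-index _)) (trans (collinear-ratio u₀≉0 v₀≉0 det≈0) (enum-index _))))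

    point : Fin (suc q) → Carrier × Carrier
    point zero    = 0# , 1#
    point (suc i) = 1# , enum i

    point-nonzero : ∀ P → NonZero₂ (point P)
    point-nonzero zero    (_ , 1≈0) = 0≉1 (sym 1≈0)
    point-nonzero (suc i) (1≈0 , _) = 0≉1 (sym 1≈0)

    slope-point : ∀ P → slope (point P) P.≡ P
    slope-point zero with zero? 0#
    ... | yes _   = P.refl
    ... | no 0≉0  = ⊥-elim (0≉0 refl)
    slope-point (suc i) with zero? 1#
    ... | yes 1≈0 = ⊥-elim (0≉1 (sym 1≈0))
    ... | no _    = P.cong suc (enum-injective _ _ (trans (sym (enum-index _)) (trans (*-congˡ (sym 1≈1⁻¹)) (*-identityʳ _))))
      where
      1≈1⁻¹ : 1# ≈ 1# ⁻¹
      1≈1⁻¹ = ⁻¹-unique (λ 1≈0 → 0≉1 (sym 1≈0)) (*-identityʳ _)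

  -- The plane geometry attached to a fixed A ∈ binom(S, k−2): coordinates
  -- with respect to B(A) = (b₁ , b₂ , A), and the projection π onto the
  -- first two coordinates.

  module PlaneOfA (q : ℕ) (order : HasOrder q) {k' N : ℕ} (S : Fin N → Vec (suc (suc k'))) (arc : IsArc S)
    (A : Subset N) (|A|≡k' : ∣ A ∣ P.≡ k') (b₁ b₂ : Vec (suc (suc k')))
    (basis : IsBasis (family b₁ b₂ S A))
    (cr : Vec (suc (suc k')) → Vec (suc (suc k')))
    (cr-correct : ∀ x → lincomb (cr x) (family b₁ b₂ S A) ≈ᵥ x) where
    open FiniteField q order

    k : ℕ
    k = suc (suc k')

    fam : Fin k → Vec k
    fam = family b₁ b₂ S A

    fam-independent : LinIndep fam
    fam-independent = proj₁ basis

    k≤N : k ℕ.≤ N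
    k≤N = proj₁ arc

    -- a default index, only used as padding for listFam
    index₀ : Fin N
    index₀ = fromℕ< {0} {N} (ℕP.≤-trans (s≤s z≤n) k≤N)

    length-A : L.length (elems A) P.≡ k'
    length-A = P.trans (elems-length A) |A|≡k'

    aₚ : Fin k' → Fin N
    aₚ p = listFam (elems A) index₀ p

    aₚ∈A : ∀ p → aₚ p ∈ A
    aₚ∈A p = elems-sound A (listFam-∈ (elems A) length-A index₀ p)

    fam-A : ∀ p → fam (suc (suc p)) P.≡ S (aₚ p)
    fam-A p = listFam-map (elems A) length-A S 0ᵥ index₀ p

    position-in-A : ∀ {a} → a ∈ A → Σ (Fin k') λ p → aₚ p P.≡ a
    position-in-A a∈A = listFam-onto (elems A) length-A index₀ (elems-complete A a∈A)

    cr-unique : ∀ {x u} → lincomb u fam ≈ᵥ x → ∀ l → cr x l ≈ u l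
    cr-unique {x} u↦x = lincomb-unique fam fam-independent (cr-correct x) u↦x

    cr-fam : ∀ j l → cr (fam j) l ≈ δ j l
    cr-fam j = cr-unique (lincomb-δ j fam)

    cr-linear : ∀ x l → cr x l ≈ sumFin (λ j → x j * cr (unit j) l)
    cr-linear x = cr-unique recombine
      where
      recombine : lincomb (λ l → sumFin (λ j → x j * cr (unit j) l)) fam ≈ᵥ x
      recombine t = begin
        sumFin (λ l → sumFin (λ j → x j * cr (unit j) l) * fam l t)     ≈⟨ sumFin-cong (λ l → trans (*-comm _ _) (trans (sym (sumFin-scale (fam l t) (λ j → x j * cr (unit j) l))) (sumFin-cong (λ j → solve 3 (λ f y z → f :* (y :* z) := y :* (z :* f)) refl (fam l t) (x j) (cr (unit j) l))))) ⟩
        sumFin (λ l → sumFin (λ j → x j * (cr (unit j) l * fam l t)))   ≈⟨ sumFin-swap (λ l j → x j * (cr (unit j) l * fam l t)) ⟩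
        sumFin (λ j → sumFin (λ l → x j * (cr (unit j) l * fam l t)))   ≈⟨ sumFin-cong (λ j → trans (sumFin-scale (x j) (λ l → cr (unit j) l * fam l t)) (*-congˡ (cr-correct (unit j) t))) ⟩
        sumFin (λ j → x j * δ j t)                                      ≈⟨ sumFin-cong (λ j → trans (*-comm (x j) (δ j t)) (*-congʳ (reflexive (δ-sym j t)))) ⟩
        sumFin (λ j → δ t j * x j)                                      ≈⟨ sumFin-δ t x ⟩
        x t                                                             ∎

    π : Vec k → Carrier × Carrier
    π x = cr x zero , cr x (suc zero)

    π-A : ∀ {a} → a ∈ A → (proj₁ (π (S a)) ≈ 0#) × (proj₂ (π (S a)) ≈ 0#)
    π-A a∈A with position-in-A a∈A
    ... | p , P.refl = trans (reflexive (P.cong (λ z → cr z zero) (P.sym (fam-A p)))) (cr-fam (suc (suc p)) zero)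
                     , trans (reflexive (P.cong (λ z → cr z (suc zero)) (P.sym (fam-A p)))) (cr-fam (suc (suc p)) (suc zero))

    -- a functional vanishing on A is  x ↦ det₂(π x , w β)
    w : Vec k → Carrier × Carrier
    w β = - apply β b₂ , apply β b₁

    VanishesOnA : Vec k → Set ℓ
    VanishesOnA β = ∀ a → a ∈ A → apply β (S a) ≈ 0#

    apply-via-π : ∀ β → VanishesOnA β → ∀ x → apply β x ≈ det₂ (π x) (w β)
    apply-via-π β vanishes x = begin
      apply β x                                    ≈⟨ apply-cong β (λ t → sym (cr-correct x t)) ⟩
      apply β (lincomb (cr x) fam)                 ≈⟨ apply-lincomb β (cr x) fam ⟩
      sumFin (λ i → cr x i * apply β (fam i))      ≈⟨ +-congˡ (+-congˡ (sumFin-zero on-A)) ⟩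
      cr x zero * apply β b₁ + (cr x (suc zero) * apply β b₂ + 0#)
        ≈⟨ solve 4 (λ x₀ x₁ β₁ β₂ → x₀ :* β₁ :+ (x₁ :* β₂ :+ :0) := x₀ :* β₁ :- x₁ :* (:- β₂)) refl (cr x zero) (cr x (suc zero)) (apply β b₁) (apply β b₂) ⟩
      det₂ (π x) (w β)                             ∎
      where
      on-A : ∀ p → cr x (suc (suc p)) * apply β (fam (suc (suc p))) ≈ 0#
      on-A p = trans (*-congˡ (trans (reflexive (P.cong (apply β) (fam-A p))) (vanishes (aₚ p) (aₚ∈A p)))) (zeroʳ _)

    det-via-π : ∀ c y → det (family (cr (S c)) (cr (S y)) (λ i → cr (S i)) A) ≈ det₂ (π (S c)) (π (S y))
    det-via-π c y = det-unit-rows₂ (family (cr (S c)) (cr (S y)) (λ i → cr (S i)) A)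
      (λ r col → trans (reflexive (P.trans (P.cong (λ f → f col) (listFam-map (elems A) length-A (λ i → cr (S i)) 0ᵥ index₀ r))
                                            (P.cong (λ z → cr z col) (P.sym (fam-A r)))))
                       (cr-fam (suc (suc r)) col))

    lift-coefficients : Carrier × Carrier → Fin k → Carrier
    lift-coefficients v zero          = proj₁ v
    lift-coefficients v (suc zero)    = proj₂ v
    lift-coefficients v (suc (suc _)) = 0#

    lift : Carrier × Carrier → Vec k
    lift v = lincomb (lift-coefficients v) fam

    π-lift : ∀ v → (proj₁ (π (lift v)) ≈ proj₁ v) × (proj₂ (π (lift v)) ≈ proj₂ v)
    π-lift v = cr-unique {u = lift-coefficients v} (λ t → refl) zero , cr-unique {u = lift-coefficients v} (λ t → refl) (suc zero)

    -- Distinct points of S outside A have projections satisfying no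
    -- nontrivial relation: α π(S i) + β π(S j) = 0 puts α S i + β S j in the
    -- span of A, a linear dependence in the k-subfamily (S i , S j , A).
    no-relation : ∀ {i j} → i ∉ A → j ∉ A → i P.≢ j → ∀ α β →
      α * proj₁ (π (S i)) + β * proj₁ (π (S j)) ≈ 0# → α * proj₂ (π (S i)) + β * proj₂ (π (S j)) ≈ 0# →
      (α ≈ 0#) × (β ≈ 0#)
    no-relation {i} {j} i∉A j∉A i≢j α β rel₀ rel₁ = vanish zero , vanish (suc zero)
      where
      ι : Fin k → Fin N
      ι = listFam (i ∷ j ∷ elems A) index₀
      ι-injective : Injective P._≡_ P._≡_ ι
      ι-injective {x} {y} = listFam-injective (i ∷ j ∷ elems A) (P.cong (λ z → suc (suc z)) length-A) index₀ distinct x y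
        where
        ∉A : ∀ {x} → x ∉ A → All (λ y → x P.≢ y) (elems A)
        ∉A x∉A = All.tabulate (λ y∈A x≡y → x∉A (P.subst (_∈ A) (P.sym x≡y) (elems-sound A y∈A)))
        distinct : Distinct (i ∷ j ∷ elems A)
        distinct = (i≢j ∷ ∉A i∉A) ∷ ∉A j∉A ∷ elems-distinct A
      e : Fin k → Carrier
      e l = α * cr (S i) l + β * cr (S j) l
      A-part : Fin k → Carrier
      A-part t = sumFin (λ p → e (suc (suc p)) * fam (suc (suc p)) t)
      A-part-correct : ∀ t → A-part t ≈ α * S i t + β * S j t
      A-part-correct t = begin
        A-part t                                                ≈⟨ solve 1 (λ z → z := :0 :+ (:0 :+ z)) refl (A-part t) ⟩
        0# + (0# + A-part t)                                    ≈⟨ +-cong (trans (*-congʳ rel₀) (zeroˡ _)) (+-congʳ (trans (*-congʳ rel₁) (zeroˡ _))) ⟨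
        lincomb e fam t                                         ≈⟨ lincomb-linear α β (cr (S i)) (cr (S j)) fam t ⟩
        α * lincomb (cr (S i)) fam t + β * lincomb (cr (S j)) fam t ≈⟨ +-cong (*-congˡ (cr-correct (S i) t)) (*-congˡ (cr-correct (S j) t)) ⟩
        α * S i t + β * S j t                                   ∎
      coefficients : Fin k → Carrier
      coefficients zero          = α
      coefficients (suc zero)    = β
      coefficients (suc (suc p)) = - e (suc (suc p))
      dependence : lincomb coefficients (λ t → S (ι t)) ≈ᵥ 0ᵥ
      dependence t = begin
        α * S i t + (β * S j t + sumFin (λ p → - e (suc (suc p)) * S (aₚ p) t))
          ≈⟨ +-congˡ (+-congˡ (sumFin-cong (λ p → trans (*-congˡ (reflexive (P.cong (λ f → f t) (P.sym (fam-A p))))) (solve 2 (λ a b → (:- a) :* b := :- (a :* b)) refl (e (suc (suc p))) (fam (suc (suc p)) t))))) ⟩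
        α * S i t + (β * S j t + sumFin (λ p → - (e (suc (suc p)) * fam (suc (suc p)) t)))
          ≈⟨ +-congˡ (+-congˡ (trans (sumFin-‿ (λ p → e (suc (suc p)) * fam (suc (suc p)) t)) (-‿cong (A-part-correct t)))) ⟩
        α * S i t + (β * S j t + - (α * S i t + β * S j t))
          ≈⟨ solve 2 (λ x y → x :+ (y :+ :- (x :+ y)) := :0) refl (α * S i t) (β * S j t) ⟩
        0#  ∎
      vanish : ∀ t → coefficients t ≈ 0#
      vanish = proj₁ (proj₂ arc ι ι-injective) coefficients dependence

    independent : ∀ {i j} → i ∉ A → j ∉ A → i P.≢ j → det₂ (π (S i)) (π (S j)) ≉ 0#
    independent i∉A j∉A i≢j det≈0 with dependent _ _ det≈0
    ... | α , β , rel₀ , rel₁ , inj₁ α≉0 = α≉0 (proj₁ (no-relation i∉A j∉A i≢j α β rel₀ rel₁))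
    ... | α , β , rel₀ , rel₁ , inj₂ β≉0 = β≉0 (proj₂ (no-relation i∉A j∉A i≢j α β rel₀ rel₁))

    partner : ∀ {i} → i ∉ A → Σ (Fin N) λ j → (j ∉ A) × (j P.≢ i)
    partner {i} i∉A = j , SubP.x∈∁p⇒x∉p (proj₁ (∈-remove⁻ j∈)) , proj₂ (∈-remove⁻ j∈)
      where
      r = proj₁ (ℕP.m≤n⇒∃[o]m+o≡n k≤N)
      N≡k+r : suc (suc (k' ℕ.+ r)) P.≡ N
      N≡k+r = proj₂ (ℕP.m≤n⇒∃[o]m+o≡n k≤N)
      i∈∁A : i ∈ ∁ A
      i∈∁A = SubP.x∉p⇒x∈∁p i∉A
      size∁A : ∣ ∁ A ∣ P.≡ suc (suc r)
      size∁A = P.trans (SubP.∣∁p∣≡n∸∣p∣ A) (P.trans (P.cong₂ ℕ._∸_ (P.trans (P.sym N≡k+r) shift) |A|≡k') (ℕP.m+n∸m≡n k' (suc (suc r))))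
        where
        shift : suc (suc (k' ℕ.+ r)) P.≡ k' ℕ.+ suc (suc r)
        shift = P.sym (P.trans (ℕP.+-suc k' (suc r)) (P.cong suc (ℕP.+-suc k' r)))
      size-rest : ∣ ∁ A ─ ⁅ i ⁆ ∣ P.≡ suc r
      size-rest = ℕP.suc-injective (P.trans (P.sym (size-remove (∁ A) i∈∁A)) size∁A)
      j = proj₁ (member (∁ A ─ ⁅ i ⁆) size-rest)
      j∈ = proj₂ (member (∁ A ─ ⁅ i ⁆) size-rest)

    π-nonzero : ∀ {i} → i ∉ A → NonZero₂ (π (S i))
    π-nonzero {i} i∉A (π₀≈0 , π₁≈0) = independent i∉A j∉A (λ e → j≢i (P.sym e))
      (trans (det₂-vertical π₀≈0) (-‿zero (trans (*-congʳ π₁≈0) (zeroˡ _))))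
      where
      j = proj₁ (partner i∉A)
      j∉A = proj₁ (proj₂ (partner i∉A))
      j≢i = proj₂ (proj₂ (partner i∉A))

    functional : Carrier × Carrier → Vec k
    functional v l = det₂ (π (unit l)) v

    apply-functional : ∀ v x → apply (functional v) x ≈ det₂ (π x) v
    apply-functional (v₀ , v₁) x = begin
      sumFin (λ l → det₂ (π (unit l)) (v₀ , v₁) * x l)
        ≈⟨ sumFin-cong (λ l → solve 5 (λ a b w₀ w₁ y → (a :* w₁ :- b :* w₀) :* y := w₁ :* (y :* a) :+ (:- w₀) :* (y :* b)) refl (cr (unit l) zero) (cr (unit l) (suc zero)) v₀ v₁ (x l)) ⟩
      sumFin (λ l → v₁ * (x l * cr (unit l) zero) + (- v₀) * (x l * cr (unit l) (suc zero)))
        ≈⟨ sumFin-+ (λ l → v₁ * (x l * cr (unit l) zero)) (λ l → (- v₀) * (x l * cr (unit l) (suc zero))) ⟩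
      sumFin (λ l → v₁ * (x l * cr (unit l) zero)) + sumFin (λ l → (- v₀) * (x l * cr (unit l) (suc zero)))
        ≈⟨ +-cong (sumFin-scale v₁ (λ l → x l * cr (unit l) zero)) (sumFin-scale (- v₀) (λ l → x l * cr (unit l) (suc zero))) ⟩
      v₁ * sumFin (λ l → x l * cr (unit l) zero) + (- v₀) * sumFin (λ l → x l * cr (unit l) (suc zero))
        ≈⟨ +-cong (*-congˡ (sym (cr-linear x zero))) (*-congˡ (sym (cr-linear x (suc zero)))) ⟩
      v₁ * cr x zero + (- v₀) * cr x (suc zero)
        ≈⟨ solve 4 (λ a b w₀ w₁ → w₁ :* a :+ (:- w₀) :* b := a :* w₁ :- b :* w₀) refl (cr x zero) (cr x (suc zero)) v₀ v₁ ⟩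
      det₂ (π x) (v₀ , v₁) ∎

    -- its values at b₁ and b₂ recover v, so it is nonzero for v ≠ 0
    functional-nonzero : ∀ v → NonZero₂ v → NonZero (functional v)
    functional-nonzero (v₀ , v₁) v≠0 γ≈0 = v≠0
      ( trans (sym (-‿involutive v₀)) (-‿zero (trans (sym at-b₂) (kills b₂)))
      , trans (sym at-b₁) (kills b₁) )
      where
      kills : ∀ x → apply (functional (v₀ , v₁)) x ≈ 0#
      kills x = sumFin-zero (λ l → trans (*-congʳ (γ≈0 l)) (zeroˡ (x l)))
      at-b₁ : apply (functional (v₀ , v₁)) b₁ ≈ v₁
      at-b₁ = trans (apply-functional _ b₁) (trans (det₂-congˡ (v₀ , v₁) (cr-fam zero zero) (cr-fam zero (suc zero)))
                (solve 2 (λ w₀ w₁ → :1 :* w₁ :- :0 :* w₀ := w₁) refl v₀ v₁))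
      at-b₂ : apply (functional (v₀ , v₁)) b₂ ≈ - v₀
      at-b₂ = trans (apply-functional _ b₂) (trans (det₂-congˡ (v₀ , v₁) (cr-fam (suc zero) zero) (cr-fam (suc zero) (suc zero)))
                (solve 2 (λ w₀ w₁ → :0 :* w₁ :- :1 :* w₀ := :- w₀) refl v₀ v₁))

    functional-vanishes : ∀ v → VanishesOnA (functional v)
    functional-vanishes v a a∈A = trans (apply-functional v (S a))
      (trans (det₂-congˡ v (proj₁ (π-A a∈A)) (proj₂ (π-A a∈A))) (solve 2 (λ w₀ w₁ → :0 :* w₁ :- :0 :* w₀ := :0) refl (proj₁ v) (proj₂ v)))

    -- The directions w β of the tangent functionals and
    -- π(S i) of the points outside A enumerate the q + 1 directions of F²,
    -- each exactly once; hence  |βs| + (N − (k − 2)) = q + 1.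

    module TangentCount (βs : List (Vec k)) (tangents : TangentFunctionals S A βs) where

      Tangent : Vec k → Set ℓ
      Tangent β = NonZero β × MeetsExactly S A β

      all-tangent : All Tangent βs
      all-tangent = proj₁ tangents

      tangent-vanishes : ∀ {β} → Tangent β → VanishesOnA β
      tangent-vanishes t a a∈A = proj₂ (proj₂ t a) a∈A

      w-nonzero : ∀ {β} → Tangent β → NonZero₂ (w β)
      w-nonzero {β} t (w₀≈0 , w₁≈0) = proj₁ t (λ l → trans (sym (apply-unit β l)) (kills (unit l)))
        where
        kills : ∀ x → apply β x ≈ 0#
        kills x = trans (apply-via-π β (tangent-vanishes t) x)
          (trans (+-cong (trans (*-congˡ w₁≈0) (zeroʳ _)) (-‿cong (trans (*-congˡ w₀≈0) (zeroʳ _)))) (solve 0 (:0 :+ (:- :0) := :0) refl))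

      same-kernel : ∀ {β γ} → Tangent β → Tangent γ → det₂ (w β) (w γ) ≈ 0# → SameKernel β γ
      same-kernel {β} {γ} tβ tγ collinear x =
        (λ βx≈0 → trans (apply-via-π γ (tangent-vanishes tγ) x)
                    (collinear-trans (π x) (w β) (w γ) (w-nonzero tβ) (trans (sym (apply-via-π β (tangent-vanishes tβ) x)) βx≈0)
                       (trans (det₂-anti (w β) (w γ)) (-‿zero collinear)))) ,
        (λ γx≈0 → trans (apply-via-π β (tangent-vanishes tβ) x)
                    (collinear-trans (π x) (w γ) (w β) (w-nonzero tγ) (trans (sym (apply-via-π γ (tangent-vanishes tγ) x)) γx≈0) collinear))

      tangent-directions point-directions directions : List (Fin (suc q))
      tangent-directions = L.map (λ β → slope (w β)) βs
      point-directions   = L.map (λ i → slope (π (S i))) (elems (∁ A))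
      directions         = tangent-directions L.++ point-directions

      outside : ∀ {i} → i ∈ₗ elems (∁ A) → i ∉ A
      outside i∈ = SubP.x∈∁p⇒x∉p (elems-sound (∁ A) i∈)

      directions-distinct : Distinct directions
      directions-distinct = AllPairsP.++⁺ tangents-distinct points-distinct across
        where
        tangents-distinct : Distinct tangent-directions
        tangents-distinct = map-distinct (λ β → slope (w β))
          (λ tβ tγ different same → different (same-kernel tβ tγ (slope-collinear _ _ same))) all-tangent (proj₁ (proj₂ tangents))
        points-distinct : Distinct point-directions
        points-distinct = map-distinct (λ i → slope (π (S i)))
          (λ i∉A j∉A i≢j same → independent i∉A j∉A i≢j (slope-collinear _ _ same)) (All.tabulate outside) (elems-distinct (∁ A))
        -- a tangent direction through a point of S outside A would make the tangent vanish there
        across : All (λ d → All (λ d′ → d P.≢ d′) point-directions) tangent-directions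
        across = AllP.map⁺ (All.tabulate (λ {β} β∈ → AllP.map⁺ (All.tabulate (λ {i} i∈ same →
          let tβ = All.lookup all-tangent β∈ in
          outside i∈ (proj₁ (proj₂ tβ i) (trans (apply-via-π β (tangent-vanishes tβ) (S i))
            (trans (det₂-anti (w β) (π (S i))) (-‿zero (slope-collinear _ _ same)))))))))

      -- If no point of S outside A has direction P, then x ↦ det₂(π x , point P)
      -- meets S exactly in A, so it is (up to scalar) one of the tangents.
      tangent-in-direction : ∀ P → (∀ i → i ∉ A → det₂ (π (S i)) (point P) ≉ 0#) →
        Σ (Vec k) λ β → (β ∈ₗ βs) × (slope (w β) P.≡ P)
      tangent-in-direction P missed = β , β∈ , P.trans (P.sym (collinear-slope _ _ (point-nonzero P) (w-nonzero tβ) collinear)) (slope-point P)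
        where
        v = point P
        γ = functional v
        γ-meets : MeetsExactly S A γ
        γ-meets i = (λ γSi≈0 → decide (i SubP.∈? A) γSi≈0) , functional-vanishes v i
          where
          decide : Dec (i ∈ A) → apply γ (S i) ≈ 0# → i ∈ A
          decide (yes i∈A) _      = i∈A
          decide (no i∉A)  γSi≈0  = ⊥-elim (missed i i∉A (trans (sym (apply-functional v (S i))) γSi≈0))
        found = find (proj₂ (proj₂ tangents) γ (functional-nonzero v (point-nonzero P)) γ-meets)
        β = proj₁ found
        β∈ = proj₁ (proj₂ found)
        tβ = All.lookup all-tangent β∈
        -- evaluate both functionals at the lift of v
        collinear : det₂ v (w β) ≈ 0#
        collinear = begin
          det₂ v (w β)                   ≈⟨ det₂-congˡ (w β) (proj₁ (π-lift v)) (proj₂ (π-lift v)) ⟨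
          det₂ (π (lift v)) (w β)        ≈⟨ apply-via-π β (tangent-vanishes tβ) (lift v) ⟨
          apply β (lift v)               ≈⟨ proj₁ (proj₂ (proj₂ found) (lift v)) γ-at-lift ⟩
          0#                             ∎
          where
          γ-at-lift : apply γ (lift v) ≈ 0#
          γ-at-lift = trans (apply-functional v (lift v)) (trans (det₂-congˡ v (proj₁ (π-lift v)) (proj₂ (π-lift v)))
            (solve 2 (λ a b → a :* b :- b :* a := :0) refl (proj₁ v) (proj₂ v)))

      directions-complete : ∀ P → P ∈ₗ directions
      directions-complete P = covered (FinP.any? (λ i → ¬? (i SubP.∈? A) ×-dec zero? (det₂ (π (S i)) (point P))))
        where
        via-point : ∀ i → i ∉ A → det₂ (π (S i)) (point P) ≈ 0# → P ∈ₗ directions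
        via-point i i∉A collinear =
          P.subst (_∈ₗ directions) (P.trans (collinear-slope _ _ (π-nonzero i∉A) (point-nonzero P) collinear) (slope-point P))
            (∈ₗP.∈-++⁺ʳ tangent-directions (∈ₗP.∈-map⁺ (λ i → slope (π (S i))) (elems-complete (∁ A) (SubP.x∉p⇒x∈∁p i∉A))))
        via-tangent : (Σ (Vec k) λ β → (β ∈ₗ βs) × (slope (w β) P.≡ P)) → P ∈ₗ directions
        via-tangent (β , β∈ , slope≡P) = P.subst (_∈ₗ directions) slope≡P (∈ₗP.∈-++⁺ˡ (∈ₗP.∈-map⁺ (λ β → slope (w β)) β∈))
        covered : Dec (∃ λ i → (i ∉ A) × (det₂ (π (S i)) (point P) ≈ 0#)) → P ∈ₗ directions
        covered (yes (i , i∉A , collinear)) = via-point i i∉A collinear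
        covered (no none) = via-tangent (tangent-in-direction P (λ i i∉A collinear → none (i , i∉A , collinear)))

      tangent-count : L.length βs ℕ.+ (N ℕ.∸ k') P.≡ suc q
      tangent-count =
        P.trans (P.cong₂ ℕ._+_ (P.sym (LP.length-map _ βs)) |outside|)
          (P.trans (P.sym (LP.length-++ tangent-directions))
            (length-of-enumeration directions directions-distinct directions-complete))
        where
        |outside| : N ℕ.∸ k' P.≡ L.length point-directions
        |outside| = P.sym (P.trans (LP.length-map _ (elems (∁ A)))
                      (P.trans (elems-length (∁ A)) (P.trans (SubP.∣∁p∣≡n∸∣p∣ A) (P.cong (N ℕ.∸_) |A|≡k'))))

  when : Bool → Carrier → Carrier
  when b x = if b then x else 0#

  when-∧ : ∀ b₁ b₂ x → when b₁ (when b₂ x) P.≡ when (b₁ ∧ b₂) x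
  when-∧ true  b₂ x = P.refl
  when-∧ false b₂ x = P.refl

  when-refuted : ∀ {p} {X : Set p} (x? : Dec X) → ¬ X → ∀ y → when (does x?) y ≈ 0#
  when-refuted (yes x) ¬x y = ⊥-elim (¬x x)
  when-refuted (no _)  ¬x y = refl

  sumSubsets-cong : ∀ {N} {f g : Subset N → Carrier} → (∀ C → f C ≈ g C) → sumSubsets f ≈ sumSubsets g
  sumSubsets-cong {zero}  h = h V.[]
  sumSubsets-cong {suc N} h = +-cong (sumSubsets-cong (λ C → h (false V.∷ C))) (sumSubsets-cong (λ C → h (true V.∷ C)))

  sumSubsets-zero : ∀ {N} {f : Subset N → Carrier} → (∀ C → f C ≈ 0#) → sumSubsets f ≈ 0#
  sumSubsets-zero {zero}  h = h V.[]
  sumSubsets-zero {suc N} h = trans (+-cong (sumSubsets-zero (λ C → h (false V.∷ C))) (sumSubsets-zero (λ C → h (true V.∷ C)))) (+-identityˡ 0#)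

  -- "A ⊆ C ⊆ X and |C| = |A|", i.e. C = A
  same-size? : ∀ {N} (A X C : Subset N) → Dec (A ⊆ C × (C ⊆ X × ∣ C ∣ P.≡ ∣ A ∣))
  same-size? A X C = A SubP.⊆? C ×-dec (C SubP.⊆? X ×-dec ∣ C ∣ ℕ.≟ ∣ A ∣)

  -- "A ⊆ C ⊆ A ∪ D and |C| = |A| + 1", i.e. C = A ∪ {c} with c ∈ D (for A, D disjoint)
  extension? : ∀ {N} (A D C : Subset N) → Dec (A ⊆ C × (C ⊆ A ∪ D × ∣ C ∣ P.≡ suc ∣ A ∣))
  extension? A D C = A SubP.⊆? C ×-dec (C SubP.⊆? (A ∪ D) ×-dec ∣ C ∣ ℕ.≟ suc ∣ A ∣)

  sum-same-size : ∀ {N} (A X : Subset N) → A ⊆ X → (ψ : Subset N → Carrier) →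
    sumSubsets (λ C → when (does (same-size? A X C)) (ψ C)) ≈ ψ A
  sum-same-size {zero}  V.[]          V.[]          A⊆X ψ = refl
  sum-same-size {suc N} (true V.∷ A)  (true V.∷ X)  A⊆X ψ =
    trans (+-cong (sumSubsets-zero {N} {λ p → when (does (same-size? (true V.∷ A) (true V.∷ X) (false V.∷ p))) (ψ (false V.∷ p))} (λ C → refl))
                  (sum-same-size A X (SubP.drop-∷-⊆ A⊆X) (λ C → ψ (true V.∷ C))))
          (+-identityˡ _)
  sum-same-size {suc N} (true V.∷ A)  (false V.∷ X) A⊆X ψ with A⊆X V.here
  ... | ()
  sum-same-size {suc N} (false V.∷ A) (x V.∷ X)     A⊆X ψ = begin
    sumSubsets (λ C → when (does (same-size? A X C)) (ψ (false V.∷ C))) + sumSubsets (λ C → when (does (same-size? (false V.∷ A) (x V.∷ X) (true V.∷ C))) (ψ (true V.∷ C)))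
      ≈⟨ +-cong (sum-same-size A X (SubP.drop-∷-⊆ A⊆X) (λ C → ψ (false V.∷ C)))
                (sumSubsets-zero (λ C → when-refuted (same-size? (false V.∷ A) (x V.∷ X) (true V.∷ C)) too-big (ψ (true V.∷ C)))) ⟩
    ψ (false V.∷ A) + 0#   ≈⟨ +-identityʳ _ ⟩
    ψ (false V.∷ A)        ∎
    where
    too-big : ∀ {C} → ¬ ((false V.∷ A) ⊆ (true V.∷ C) × ((true V.∷ C) ⊆ (x V.∷ X) × suc ∣ C ∣ P.≡ ∣ A ∣))
    too-big (A⊆C , _ , size) = ℕP.<-irrefl P.refl (ℕP.≤-trans (ℕP.≤-reflexive size) (SubP.p⊆q⇒∣p∣≤∣q∣ (SubP.drop-∷-⊆ A⊆C)))

  sum-extensions : ∀ {N} (A D : Subset N) → (∀ {i} → i ∈ A → i ∈ D → ⊥) → (φ : Subset N → Carrier) →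
    sumSubsets (λ C → when (does (extension? A D C)) (φ C)) ≈ sumOver D (λ c → φ (A ∪ ⁅ c ⁆))
  sum-extensions {zero}  V.[]          V.[]          disjoint φ = refl
  sum-extensions {suc N} (true V.∷ A)  (true V.∷ D)  disjoint φ = ⊥-elim (disjoint V.here V.here)
  sum-extensions {suc N} (true V.∷ A)  (false V.∷ D) disjoint φ = begin
    _    ≈⟨ trans (+-congʳ (sumSubsets-zero {N} {λ p → when (does (extension? (true V.∷ A) (false V.∷ D) (false V.∷ p))) (φ (false V.∷ p))} (λ C → refl))) (+-identityˡ _) ⟩
    sumSubsets (λ C → when (does (extension? A D C)) (φ (true V.∷ C)))   ≈⟨ sum-extensions A D (λ a d → disjoint (V.there a) (V.there d)) (λ C → φ (true V.∷ C)) ⟩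
    sumOver D (λ c → φ (true V.∷ (A ∪ ⁅ c ⁆)))                            ≡⟨ ΣS.fold-outside D (λ c → φ ((true V.∷ A) ∪ ⁅ c ⁆)) ⟨
    sumOver (false V.∷ D) (λ c → φ ((true V.∷ A) ∪ ⁅ c ⁆))                ∎
  sum-extensions {suc N} (false V.∷ A) (false V.∷ D) disjoint φ = begin
    sumSubsets (λ C → when (does (extension? A D C)) (φ (false V.∷ C))) + sumSubsets (λ C → when (does (extension? (false V.∷ A) (false V.∷ D) (true V.∷ C))) (φ (true V.∷ C)))
      ≈⟨ +-cong (sum-extensions A D (λ a d → disjoint (V.there a) (V.there d)) (λ C → φ (false V.∷ C)))
                (sumSubsets-zero (λ C → when-refuted (extension? (false V.∷ A) (false V.∷ D) (true V.∷ C)) (λ (_ , C⊆ , _) → outside (C⊆ V.here)) (φ (true V.∷ C)))) ⟩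
    sumOver D (λ c → φ (false V.∷ (A ∪ ⁅ c ⁆))) + 0#     ≈⟨ +-identityʳ _ ⟩
    sumOver D (λ c → φ (false V.∷ (A ∪ ⁅ c ⁆)))          ≡⟨ ΣS.fold-outside D (λ c → φ ((false V.∷ A) ∪ ⁅ c ⁆)) ⟨
    sumOver (false V.∷ D) (λ c → φ ((false V.∷ A) ∪ ⁅ c ⁆)) ∎
    where
    outside : zero ∉ (false V.∷ A) ∪ (false V.∷ D)
    outside ()
  sum-extensions {suc N} (false V.∷ A) (true V.∷ D)  disjoint φ = begin
    sumSubsets (λ C → when (does (extension? A D C)) (φ (false V.∷ C))) + sumSubsets (λ C → when (does (same-size? A (A ∪ D) C)) (φ (true V.∷ C)))
      ≈⟨ +-cong (sum-extensions A D (λ a d → disjoint (V.there a) (V.there d)) (λ C → φ (false V.∷ C))) (sum-same-size A (A ∪ D) (SubP.p⊆p∪q D) (λ C → φ (true V.∷ C))) ⟩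
    sumOver D (λ c → φ (false V.∷ (A ∪ ⁅ c ⁆))) + φ (true V.∷ A)                  ≈⟨ +-comm _ _ ⟩
    φ (true V.∷ A) + sumOver D (λ c → φ (false V.∷ (A ∪ ⁅ c ⁆)))                  ≡⟨ P.cong (λ z → φ (true V.∷ z) + sumOver D (λ c → φ (false V.∷ (A ∪ ⁅ c ⁆)))) (SubP.∪-identityʳ A) ⟨
    φ (true V.∷ (A ∪ Sub.⊥)) + sumOver D (λ c → φ (false V.∷ (A ∪ ⁅ c ⁆)))        ≡⟨ ΣS.fold-inside D (λ c → φ ((false V.∷ A) ∪ ⁅ c ⁆)) ⟨
    sumOver (true V.∷ D) (λ c → φ ((false V.∷ A) ∪ ⁅ c ⁆))                        ∎

  module Column (q : ℕ) (order : HasOrder q) {k' N : ℕ} (S : Fin N → Vec (suc (suc k'))) (arc : IsArc S)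
    (n : ℕ) (G : Subset N) (|G|+N : ∣ G ∣ ℕ.+ N P.≡ (q ℕ.+ suc k') ℕ.+ suc (suc k') ℕ.+ n)
    (b₁ b₂ : Subset N → Vec (suc (suc k')))
    (bases : ∀ A → A ⊆ G → ∣ A ∣ P.≡ k' → IsBasis (family (b₁ A) (b₂ A) S A))
    (crd : Subset N → Vec (suc (suc k')) → Vec (suc (suc k')))
    (crd-correct : ∀ A → A ⊆ G → ∣ A ∣ P.≡ k' → ∀ x → lincomb (crd A x) (family (b₁ A) (b₂ A) S A) ≈ᵥ x)
    (βs : Subset N → List (Vec (suc (suc k'))))
    (tangents : ∀ A → A ⊆ G → ∣ A ∣ P.≡ k' → TangentFunctionals S A (βs A))
    (U A : Subset N) (U⊆G : U ⊆ G) (|U|≡n : ∣ U ∣ P.≡ n) (A⊆G-U : A ⊆ G ─ U) (|A|≡k' : ∣ A ∣ P.≡ k') where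

    A⊆G : A ⊆ G
    A⊆G a∈A = SubP.p─q⊆p G U (A⊆G-U a∈A)

    open PlaneOfA q order S arc A |A|≡k' (b₁ A) (b₂ A) (bases A A⊆G |A|≡k') (crd A) (crd-correct A A⊆G |A|≡k')
    open TangentCount (βs A) (tangents A A⊆G |A|≡k')

    -- the candidates c for rows C = A ∪ {c}
    D : Subset N
    D = (G ─ U) ─ A

    ws : List (Carrier × Carrier)
    ws = L.map w (βs A)

    open Interpolation (λ i → π (S i)) public

    D∩A-empty : ∀ {i} → i ∈ A → i ∈ D → ⊥
    D∩A-empty i∈A i∈D = proj₂ (∈-─⁻ i∈D) i∈A

    entry : Subset N → Carrier
    entry C = sumOver (C ─ A) (λ c → tangent (βs A) (S c) *
                prodOver (G ─ (C ∪ U)) (λ y → det (family (crd A (S c)) (crd A (S y)) (λ i → crd A (S i)) A) ⁻¹))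

    row-condition⇒extension : ∀ C → (C ⊆ G × ∣ C ∣ P.≡ suc k') × (A ⊆ C × C ⊆ G ─ U) →
      A ⊆ C × (C ⊆ A ∪ D × ∣ C ∣ P.≡ suc ∣ A ∣)
    row-condition⇒extension C ((C⊆G , |C|) , (A⊆C , C⊆G-U)) = A⊆C , (λ x∈C → split (C⊆G-U x∈C)) , P.trans |C| (P.cong suc (P.sym |A|≡k'))
      where
      split : ∀ {x} → x ∈ G ─ U → x ∈ A ∪ D
      split {x} x∈ with x SubP.∈? A
      ... | yes x∈A = SubP.x∈p∪q⁺ (inj₁ x∈A)
      ... | no  x∉A = SubP.x∈p∪q⁺ (inj₂ (SubP.x∈p∧x∉q⇒x∈p─q x∈ x∉A))

    extension⇒row-condition : ∀ C → A ⊆ C × (C ⊆ A ∪ D × ∣ C ∣ P.≡ suc ∣ A ∣) →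
      (C ⊆ G × ∣ C ∣ P.≡ suc k') × (A ⊆ C × C ⊆ G ─ U)
    extension⇒row-condition C (A⊆C , C⊆A∪D , |C|) =
      ((λ x∈C → SubP.p─q⊆p G U (A∪D⊆G-U (C⊆A∪D x∈C))) , P.trans |C| (P.cong suc |A|≡k')) , (A⊆C , λ x∈C → A∪D⊆G-U (C⊆A∪D x∈C))
      where
      A∪D⊆G-U : A ∪ D ⊆ G ─ U
      A∪D⊆G-U x∈ = [ A⊆G-U , SubP.p─q⊆p (G ─ U) A ] (SubP.x∈p∪q⁻ A D x∈)

    rows-are-extensions : onesTimesP S G βs crd U A ≈ sumSubsets (λ C → when (does (extension? A D C)) (entry C))
    rows-are-extensions = sumSubsets-cong (λ C → reflexive (P.trans
      (when-∧ (does (C SubP.⊆? G) ∧ does (∣ C ∣ ℕ.≟ suc k')) (does (A SubP.⊆? C) ∧ does (C SubP.⊆? (G ─ U))) (entry C))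
      (P.cong (λ b → when b (entry C))
        (does-cong ((C SubP.⊆? G ×-dec ∣ C ∣ ℕ.≟ suc k') ×-dec (A SubP.⊆? C ×-dec C SubP.⊆? (G ─ U))) (extension? A D C)
                   (row-condition⇒extension C) (extension⇒row-condition C)))))

    tangent-as-numerator : ∀ c {l} → All Tangent l → tangent l (S c) ≈ numerator (L.map w l) c
    tangent-as-numerator c []               = refl
    tangent-as-numerator c {β ∷ l} (tβ ∷ t) = *-cong (apply-via-π β (tangent-vanishes tβ) (S c)) (tangent-as-numerator c t)

    G∖row : ∀ c → G ─ ((A ∪ ⁅ c ⁆) ∪ U) P.≡ D ─ ⁅ c ⁆
    G∖row c = P.sym (P.trans (P.cong (_─ ⁅ c ⁆) (SubP.p─q─r≡p─q∪r G U A))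
                (P.trans (SubP.p─q─r≡p─q∪r G (U ∪ A) ⁅ c ⁆)
                  (P.cong (G ─_) (P.trans (SubP.∪-assoc U A ⁅ c ⁆) (SubP.∪-comm U (A ∪ ⁅ c ⁆))))))

    D-independent : Independent D
    D-independent x∈D y∈D = independent (proj₂ (∈-─⁻ x∈D)) (proj₂ (∈-─⁻ y∈D))

    entry-as-term : ∀ c → c ∈ D → entry (A ∪ ⁅ c ⁆) ≈ term D ws c
    entry-as-term c c∈D = begin
      sumOver ((A ∪ ⁅ c ⁆) ─ A) (λ c′ → f c′ * Π c′ (A ∪ ⁅ c ⁆))   ≡⟨ P.cong (λ z → sumOver z (λ c′ → f c′ * Π c′ (A ∪ ⁅ c ⁆))) (extension-difference A c (proj₂ (∈-─⁻ c∈D))) ⟩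
      sumOver ⁅ c ⁆ (λ c′ → f c′ * Π c′ (A ∪ ⁅ c ⁆))              ≈⟨ sumOver-singleton c (λ c′ → f c′ * Π c′ (A ∪ ⁅ c ⁆)) ⟩
      f c * prodOver (G ─ ((A ∪ ⁅ c ⁆) ∪ U)) (det⁻¹ c)            ≡⟨ P.cong (λ z → f c * prodOver z (det⁻¹ c)) (G∖row c) ⟩
      f c * prodOver (D ─ ⁅ c ⁆) (det⁻¹ c)                        ≈⟨ *-cong (tangent-as-numerator c all-tangent) (ΠS.fold-cong (D ─ ⁅ c ⁆) det⁻¹-via-π) ⟩
      term D ws c                                                 ∎
      where
      f : Fin N → Carrier
      f c′ = tangent (βs A) (S c′)
      det⁻¹ : Fin N → Fin N → Carrier
      det⁻¹ c′ y = det (family (crd A (S c′)) (crd A (S y)) (λ i → crd A (S i)) A) ⁻¹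
      Π : Fin N → Subset N → Carrier
      Π c′ C = prodOver (G ─ (C ∪ U)) (det⁻¹ c′)
      det⁻¹-via-π : ∀ y → y ∈ D ─ ⁅ c ⁆ → det⁻¹ c y ≈ inv c y
      det⁻¹-via-π y y∈ = ⁻¹-cong (λ det≈0 → D-independent c∈D y∈D (λ e → y≢c (P.sym e)) (trans (sym (det-via-π c y)) det≈0)) (det-via-π c y)
        where
        y∈D = proj₁ (∈-remove⁻ y∈)
        y≢c = proj₂ (∈-remove⁻ y∈)

    size-D : ∣ D ∣ P.≡ suc (suc (L.length ws))
    size-D = P.trans
      (size-arithmetic
        (P.trans (P.cong (∣ D ∣ ℕ.+_) (P.sym |A|≡k')) (size-difference (G ─ U) A A⊆G-U))
        (P.trans (P.cong (∣ G ─ U ∣ ℕ.+_) (P.sym |U|≡n)) (size-difference G U U⊆G))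
        (ℕP.m∸n+n≡m (ℕP.≤-trans (ℕP.n≤1+n k') (ℕP.≤-trans (ℕP.n≤1+n (suc k')) k≤N)))
        tangent-count
        |G|+N)
      (P.cong (λ z → suc (suc z)) (P.sym (LP.length-map w (βs A))))

open import Data.Nat using (_+_; _∸_; _≤_)
open import Relation.Binary.PropositionalEquality using (_≡_)

corollary4p1 :
    ∀ {c ℓ : Level} (F : Field c ℓ) (q : ℕ) → FieldDefs.HasOrder F q →
    (k : ℕ) → 2 ≤ k →
    (N : ℕ) (S : Fin N → FieldDefs.Vec F k) → FieldDefs.IsArc F S →
    (n : ℕ) (G : Subset N) →
    -- |G| = t + k + n  with  t = q + k - 1 - |S|
    ∣ G ∣ + N ≡ (q + (k ∸ 1)) + k + n →
    -- B(A) = (b₁ A, b₂ A, A) is a basis for every A ∈ binom(G, k-2)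
    (b₁ b₂ : Subset N → FieldDefs.Vec F k) →
    (∀ A → A ⊆ G → ∣ A ∣ ≡ k ∸ 2 →
       FieldDefs.IsBasis F (FieldDefs.family F (b₁ A) (b₂ A) S A)) →
    -- crd A x : the coordinates of x with respect to B(A)
    (crd : Subset N → FieldDefs.Vec F k → FieldDefs.Vec F k) →
    (∀ A → A ⊆ G → ∣ A ∣ ≡ k ∸ 2 → ∀ x →
       FieldDefs._≈ᵥ_ F
         (FieldDefs.lincomb F (crd A x) (FieldDefs.family F (b₁ A) (b₂ A) S A)) x) →
    -- any choice of tangent functionals β_A^i  (f_{A,S} = product of them)
    (βs : Subset N → List (FieldDefs.Vec F k)) →
    (∀ A → A ⊆ G → ∣ A ∣ ≡ k ∸ 2 → FieldDefs.TangentFunctionals F S A (βs A)) →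
    -- every column (U , A) of 1 · P_G^{↑n} vanishes
    ∀ (U A : Subset N) → U ⊆ G → ∣ U ∣ ≡ n → A ⊆ (G ─ U) → ∣ A ∣ ≡ k ∸ 2 →
    Field._≈_ F (FieldDefs.onesTimesP F S G βs crd U A) (Field.0# F)
corollary4p1 F q order (suc (suc k')) (s≤s (s≤s z≤n)) N S arc n G |G|+N b₁ b₂ bases crd crd-correct βs tangents U A U⊆G |U|≡n A⊆G-U |A|≡k' =
  begin
    onesTimesP S G βs crd U A                                   ≈⟨ rows-are-extensions ⟩
    sumSubsets (λ C → when (does (extension? A D C)) (entry C)) ≈⟨ sum-extensions A D D∩A-empty entry ⟩
    sumOver D (λ c → entry (A ∪ ⁅ c ⁆))                         ≈⟨ ΣS.fold-cong D entry-as-term ⟩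
    interpolationSum D ws                                       ≈⟨ interpolation ws D D-independent size-D ⟩
    0#                                                          ∎
  where
  open Field F using (0#)
  open FieldDefs F using (onesTimesP; sumSubsets; sumOver)
  open OverField F
  open Column q order S arc n G |G|+N b₁ b₂ bases crd crd-correct βs tangents U A U⊆G |U|≡n A⊆G-U |A|≡k'
  open import Relation.Binary.Reasoning.Setoid (Field.setoid F)
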